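{- We have $$g_3(x) = \frac{x^3-x+1}{(1-x)(1-x-x^2)},$$ and for all $k > 3$, $$g_k(x) = \frac{1}{1-x} \left( 1 + x ( g_{k-1}(x) - 1 ) + \sum_{r=2}^{k-2} x^r ( g_{k-r+1}(x) - 1 ) + \frac{x^{k-1}}{1-x} ( g_3(x) - 1) \right).$$
   Context: $S_n$ is the set of permutations of $\{1,\dots,n\}$ in one-line notation; $\pi$ avoids $\sigma\in S_k$ if no subsequence of $\pi$ of length $k$ has the same relative order as $\sigma$; $S_n(R)$ is the set of $\pi\in S_n$ avoiding every element of $R$, and $S_0(R)$ contains only the empty permutation. For $k\ge 4$, $\omega_k\in S_k$ is $\omega_k = k, k-1, \ldots, 5, 4, 2, 1, 3$, and $\omega_3 = 213$. For $k \ge 3$, $g_k(x) = \sum_{n\ge0} |S_n(132, 2341, \omega_k)| x^n$. -}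

module Defs where

open import Data.Nat using (ℕ; zero; suc; _∸_; _<ᵇ_; _≡ᵇ_)
open import Data.Bool using (Bool; true; false; _∧_; _∨_; not; if_then_else_)
open import Data.List using (List; []; _∷_; _++_; map; concatMap; filter; length; foldr; upTo; zip)
open import Data.Bool.ListAction using (all; any)
open import Data.Product using (_,_)
open import Data.Integer using (ℤ; +_; -_) renaming (_+_ to _+ℤ_; _*_ to _*ℤ_; _-_ to _-ℤ_)
open import Relation.Binary.PropositionalEquality using (_≡_)
open import Relation.Nullary.Decidable using (T?)

-- Permutations of {1,…,n} in one-line notation, as lists of naturals

allLists : ℕ → ℕ → List (List ℕ)
allLists zero    m = [] ∷ []
allLists (suc n) m = concatMap (λ x → map (x ∷_) (allLists n m)) (map suc (upTo m))

notElem : ℕ → List ℕ → Bool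
notElem x xs = all (λ y → not (x ≡ᵇ y)) xs

distinct : List ℕ → Bool
distinct []       = true
distinct (x ∷ xs) = notElem x xs ∧ distinct xs

Sn : ℕ → List (List ℕ)
Sn n = filter (λ π → T? (distinct π)) (allLists n n)

subseqs : List ℕ → List (List ℕ)
subseqs []       = [] ∷ []
subseqs (x ∷ xs) = let r = subseqs xs in map (x ∷_) r ++ r

iff : Bool → Bool → Bool
iff a b = (a ∧ b) ∨ (not a ∧ not b)

sameOrder : List ℕ → List ℕ → Bool
sameOrder []       []       = true
sameOrder []       (_ ∷ _)  = false
sameOrder (_ ∷ _)  []       = false
sameOrder (a ∷ as) (b ∷ bs) =
  all (λ { (x , y) → iff (a <ᵇ x) (b <ᵇ y) ∧ iff (x <ᵇ a) (y <ᵇ b) }) (zip as bs)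
  ∧ sameOrder as bs

contains : List ℕ → List ℕ → Bool
contains π σ = any (sameOrder σ) (subseqs π)

avoids : List ℕ → List ℕ → Bool
avoids π σ = not (contains π σ)

descTo4 : ℕ → List ℕ
descTo4 zero = []
descTo4 (suc k) with 3 <ᵇ suc k
... | true  = suc k ∷ descTo4 k
... | false = []

-- ω_k = k, k-1, …, 4, 2, 1, 3 for k ≥ 4, and ω_3 = 213
ω : ℕ → List ℕ
ω k = descTo4 k ++ (2 ∷ 1 ∷ 3 ∷ [])

p132 : List ℕ
p132 = 1 ∷ 3 ∷ 2 ∷ []

p2341 : List ℕ
p2341 = 2 ∷ 3 ∷ 4 ∷ 1 ∷ []

count : ℕ → ℕ → ℕ
count k n = length (filter (λ π → T? (avoids π p132 ∧ avoids π p2341 ∧ avoids π (ω k))) (Sn n))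

-- Formal power series over ℤ as coefficient sequences

Series : Set
Series = ℕ → ℤ

_≈_ : Series → Series → Set
f ≈ g = ∀ n → f n ≡ g n

infix 4 _≈_
infixl 6 _⊕_ _⊖_
infixl 7 _⊛_

_⊕_ : Series → Series → Series
(f ⊕ g) n = f n +ℤ g n

_⊖_ : Series → Series → Series
(f ⊖ g) n = f n -ℤ g n

_⊛_ : Series → Series → Series
(f ⊛ g) n = foldr _+ℤ_ (+ 0) (map (λ i → f i *ℤ g (n ∸ i)) (upTo (suc n)))

X^ : ℕ → Series
X^ r n = if r ≡ᵇ n then + 1 else + 0

one : Series
one = X^ 0

sumS : List Series → Series
sumS = foldr _⊕_ (λ _ → + 0)

g : ℕ → Series
g k n = + count k n

-- Write π ∈ S_{m+1} as α (m+1) β. If π avoids 132, every entry of α exceeds every entry of β.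
-- If β is empty, π avoids {132, 2341, ω_k} iff α does when k ≥ 4, and iff α is increasing when k = 3.
-- Otherwise, avoiding 2341 forces α to be decreasing, so α = m, m−1, …, m−a+1 and β ∈ S_{m−a}; then π
-- avoids the three patterns iff β avoids 132, 2341 and ω_{max(3, k − max(1, a))} (and a ≤ 1 when k = 3).
-- Hence c_k(m+1) = c_k(m) + Σ_{a<m} c_{max(3, k − max(1,a))}(m − a) for k ≥ 4 and
-- c_3(m+1) = 1 + Σ_{a < min(2, m)} c_3(m − a), and both identities are these recursions read off
-- coefficientwise.
module Submission where

open import Defs

open import Data.Bool using (Bool; true; false; _∧_; not; T)
open import Data.Bool.Properties using (T-∧; T-≡; T-not-≡; ∧-assoc; ∧-identityʳ; ∧-commutativeMonoid)
open import Algebra.Bundles using (CommutativeMonoid)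
open import Algebra.Properties.CommutativeSemigroup (CommutativeMonoid.commutativeSemigroup ∧-commutativeMonoid)
  using (x∙yz≈y∙xz)
open import Data.Bool.ListAction using (all; any)
open import Data.Empty using (⊥; ⊥-elim)
open import Data.List using (List; []; _∷_; _++_; [_]; map; length; zip; concatMap; filter; upTo; applyUpTo; foldr)
open import Data.Nat.ListAction using (sum)
import Data.Integer as ℤ
open import Data.Integer using (ℤ; 0ℤ; 1ℤ) renaming (_+_ to _+ℤ_; _-_ to _-ℤ_; _*_ to _*ℤ_)
open import Data.Integer.Properties using (*-distribʳ-+; *-zeroˡ; *-identityˡ; +-identityˡ)
  renaming (+-identityʳ to +ℤ-identityʳ)
open import Data.Integer.Tactic.RingSolver using (solve-∀)
open import Data.List.Properties
  using (length-++; length-map; map-cong; map-∘; map-applyUpTo; ++-identityʳ; ++-assoc; ++-cancelˡ; ∷-injective; ∷-injectiveˡ; ∷-injectiveʳ; ∷ʳ-injective)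
open import Data.List.Relation.Binary.Sublist.Propositional
  using (_⊆_; []; _∷_; _∷ʳ_; ⊆-refl; ⊆-trans; from∈; to∈)
open import Data.List.Relation.Binary.Sublist.Propositional.Properties
  using (++⁺; ++⁺ˡ; ++⁺ʳ; ∷ˡ⁻; []⊆-universal; length-mono-≤; All-resp-⊆)
open import Data.List.Membership.Propositional using (_∈_; find; lose)
open import Data.List.Membership.Propositional.Properties using (∈-map⁺; ∈-map⁻; ∈-++⁺ˡ; ∈-++⁺ʳ; ∈-++⁻; ∈-∃++; ∈-filter⁺; ∈-filter⁻;
         ∈-concatMap⁺; ∈-concatMap⁻; ∈-upTo⁺; ∈-upTo⁻)
open import Data.List.Relation.Binary.Subset.Propositional using () renaming (_⊆_ to _⊆ˢ_)
import Data.List.Membership.DecPropositional as DecMembership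
open import Data.List.Relation.Unary.All using (All; []; _∷_)
import Data.List.Relation.Unary.All as All
import Data.List.Relation.Unary.All.Properties as Allₚ
open import Data.List.Relation.Unary.AllPairs using (AllPairs; []; _∷_)
import Data.List.Relation.Unary.AllPairs as AllPairs
open import Data.List.Relation.Unary.Unique.Propositional using (Unique)
import Data.List.Relation.Unary.Unique.Propositional.Properties as Uniqueₚ
open import Data.List.Relation.Unary.Any using (here; there)
import Data.List.Relation.Unary.Any.Properties as Anyₚ
open import Data.Nat using (ℕ; zero; suc; _<_; _≤_; _>_; _+_; _∸_; _⊓_; _⊔_; _<ᵇ_; z≤n; s≤s)
open import Data.Nat.Properties
  using (<ᵇ⇒<; <⇒<ᵇ; <⇒≯; <-trans; <-cmp; _<?_; n≤0⇒n≡0; <⇒≱; <⇒≢; >⇒≢; ≮⇒≥; ≤∧≢⇒<; suc-injective; ≤-refl; ≤-reflexive; ≤-trans; ≤-antisym; ≤-pred;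
         n≤1+n; 1+n≰n; m≤m+n; <⇒≤; ⊓-zeroʳ; m>n⇒m∸n≢0; n≢0⇒n>0; +-monoˡ-≤; m+n∸n≡m; ≤-<-trans; <-asym; m⊓n≤m; m⊓n≤n; m≤m⊔n; m≤n⊔m; ⊓-glb;
         m∸n+n≡m; m+[n∸m]≡n; m+n∸m≡n; ∸-monoʳ-≤; ≡ᵇ⇒≡; ≡⇒≡ᵇ; +-suc; +-identityʳ; +-comm; +-assoc; +-monoʳ-≤; _≟_;
         module ≤-Reasoning)
open import Data.Product using (∃; ∃₂; _×_; _,_; proj₁; proj₂)
open import Data.Sum using (_⊎_; inj₁; inj₂)
open import Data.Unit using (tt)
open import Function using (_∘_; _$_; _⇔_; Equivalence; mk⇔; case_of_)
open import Relation.Binary using (tri<; tri≈; tri>)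
open import Relation.Binary.PropositionalEquality using (_≡_; _≢_; refl; sym; trans; cong; cong₂; subst; module ≡-Reasoning)
open import Relation.Nullary using (¬_; yes; no)
open import Relation.Nullary.Decidable using (T?)

open Equivalence using (to; from)

T-not : ∀ {b} → T (not b) ⇔ (¬ T b)
T-not {false} = mk⇔ (λ _ ()) (λ _ → tt)
T-not {true} = mk⇔ (λ ()) (λ ¬t → ¬t tt)

-- Subsequences and containment

∈-subseqs⁻ : ∀ {s} π → s ∈ subseqs π → s ⊆ π
∈-subseqs⁻ [] (here refl) = []
∈-subseqs⁻ (x ∷ π) p with ∈-++⁻ (map (x ∷_) (subseqs π)) p
... | inj₁ q with ∈-map⁻ (x ∷_) q
...   | s , s∈ , refl = refl ∷ ∈-subseqs⁻ π s∈
∈-subseqs⁻ (x ∷ π) p | inj₂ q = x ∷ʳ ∈-subseqs⁻ π q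

∈-subseqs⁺ : ∀ {s π} → s ⊆ π → s ∈ subseqs π
∈-subseqs⁺ [] = here refl
∈-subseqs⁺ {π = x ∷ π} (.x ∷ʳ p) = ∈-++⁺ʳ (map (x ∷_) (subseqs π)) (∈-subseqs⁺ p)
∈-subseqs⁺ (refl ∷ p) = ∈-++⁺ˡ (∈-map⁺ (_ ∷_) (∈-subseqs⁺ p))

record Contains (π σ : List ℕ) : Set where
  constructor occ
  field
    {s}   : List ℕ
    s⊆π   : s ⊆ π
    order : T (sameOrder σ s)

contains⇔Contains : ∀ π σ → T (contains π σ) ⇔ Contains π σ
contains⇔Contains π σ =
  mk⇔ (λ t → let (s , s∈ , o) = find (Anyₚ.any⁻ (sameOrder σ) (subseqs π) t) in occ (∈-subseqs⁻ π s∈) o)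
      (λ (occ s⊆π o) → Anyₚ.any⁺ (sameOrder σ) (lose (∈-subseqs⁺ s⊆π) o))

avoids⇔¬Contains : ∀ π σ → T (avoids π σ) ⇔ (¬ Contains π σ)
avoids⇔¬Contains π σ = mk⇔ (λ t → to T-not t ∘ from (contains⇔Contains π σ))
                           (λ ¬c → from T-not (¬c ∘ to (contains⇔Contains π σ)))

Contains-mono : ∀ {β π σ} → β ⊆ π → Contains β σ → Contains π σ
Contains-mono β⊆π (occ s⊆β o) = occ (⊆-trans s⊆β β⊆π) o

-- Relative order

<ᵇ≡true : ∀ {m n} → m < n → (m <ᵇ n) ≡ true
<ᵇ≡true = to T-≡ ∘ <⇒<ᵇ

<ᵇ≡false : ∀ {m n} → ¬ m < n → (m <ᵇ n) ≡ false
<ᵇ≡false {m} {n} m≮n = to T-not-≡ (from T-not (m≮n ∘ <ᵇ⇒< m n))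

agree : ℕ → ℕ → ℕ → ℕ → Bool
agree a b x y = iff (a <ᵇ x) (b <ᵇ y) ∧ iff (x <ᵇ a) (y <ᵇ b)

agreeAll : ℕ → ℕ → List ℕ → List ℕ → Bool
agreeAll a b (x ∷ σ) (y ∷ s) = agree a b x y ∧ agreeAll a b σ s
agreeAll a b _ _ = true

crossAgree : List ℕ → List ℕ → List ℕ → List ℕ → Bool
crossAgree (a ∷ σ₁) (b ∷ s₁) σ₂ s₂ = agreeAll a b σ₂ s₂ ∧ crossAgree σ₁ s₁ σ₂ s₂
crossAgree _ _ σ₂ s₂ = true

sameOrder-∷ : ∀ a b σ s → sameOrder (a ∷ σ) (b ∷ s) ≡ agreeAll a b σ s ∧ sameOrder σ s
sameOrder-∷ a b σ s = cong (_∧ sameOrder σ s) (all-zip σ s)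
  where
  all-zip : ∀ σ s → all _ (zip σ s) ≡ agreeAll a b σ s
  all-zip [] [] = refl
  all-zip [] (_ ∷ _) = refl
  all-zip (_ ∷ _) [] = refl
  all-zip (x ∷ σ) (y ∷ s) = cong (agree a b x y ∧_) (all-zip σ s)

sameOrder-head : ∀ {a b σ s} → T (sameOrder (a ∷ σ) (b ∷ s)) → T (agreeAll a b σ s)
sameOrder-head {a} {b} {σ} {s} o = proj₁ (to T-∧ (subst T (sameOrder-∷ a b σ s) o))

sameOrder-tail : ∀ {a b σ s} → T (sameOrder (a ∷ σ) (b ∷ s)) → T (sameOrder σ s)
sameOrder-tail {a} {b} {σ} {s} o = proj₂ (to T-∧ (subst T (sameOrder-∷ a b σ s) o))

sameOrder-cons : ∀ {a b σ s} → T (agreeAll a b σ s) → T (sameOrder σ s) → T (sameOrder (a ∷ σ) (b ∷ s))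
sameOrder-cons {a} {b} {σ} {s} h o = subst T (sym (sameOrder-∷ a b σ s)) (from T-∧ (h , o))

sameOrder⇒length≡ : ∀ σ s → T (sameOrder σ s) → length σ ≡ length s
sameOrder⇒length≡ [] [] _ = refl
sameOrder⇒length≡ (a ∷ σ) (b ∷ s) o = cong suc (sameOrder⇒length≡ σ s (sameOrder-tail {a} {b} {σ} {s} o))

agreeAll-++ : ∀ a b σ s σ′ s′ → length σ ≡ length s →
              agreeAll a b (σ ++ σ′) (s ++ s′) ≡ agreeAll a b σ s ∧ agreeAll a b σ′ s′
agreeAll-++ a b [] [] σ′ s′ _ = refl
agreeAll-++ a b (x ∷ σ) (y ∷ s) σ′ s′ e =
  trans (cong (agree a b x y ∧_) (agreeAll-++ a b σ s σ′ s′ (suc-injective e)))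
        (sym (∧-assoc (agree a b x y) _ _))

sameOrder-++ : ∀ σ₁ s₁ σ₂ s₂ → length σ₁ ≡ length s₁ →
               sameOrder (σ₁ ++ σ₂) (s₁ ++ s₂) ≡ (sameOrder σ₁ s₁ ∧ sameOrder σ₂ s₂) ∧ crossAgree σ₁ s₁ σ₂ s₂
sameOrder-++ [] [] σ₂ s₂ _ = sym (∧-identityʳ _)
sameOrder-++ (a ∷ σ₁) (b ∷ s₁) σ₂ s₂ e
  rewrite sameOrder-∷ a b (σ₁ ++ σ₂) (s₁ ++ s₂) | sameOrder-∷ a b σ₁ s₁
        | agreeAll-++ a b σ₁ s₁ σ₂ s₂ (suc-injective e) | sameOrder-++ σ₁ s₁ σ₂ s₂ (suc-injective e)
  = rearrange (agreeAll a b σ₁ s₁) (sameOrder σ₁ s₁) (agreeAll a b σ₂ s₂) (sameOrder σ₂ s₂) (crossAgree σ₁ s₁ σ₂ s₂)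
  where
  rearrange : ∀ p q r t u → (p ∧ r) ∧ ((q ∧ t) ∧ u) ≡ ((p ∧ q) ∧ t) ∧ (r ∧ u)
  rearrange false q r t u = refl
  rearrange true q r t u = x∙yz≈y∙xz r (q ∧ t) u

agree-below : ∀ a b x y → y < b → agree a b x y ≡ (x <ᵇ a)
agree-below a b x y y<b rewrite <ᵇ≡true y<b | <ᵇ≡false (<⇒≯ y<b) with x <ᵇ a in x<a | a <ᵇ x in a<x
... | false | false = refl
... | false | true = refl
... | true | false = refl
... | true | true = ⊥-elim (<⇒≯ (<ᵇ⇒< x a (subst T (sym x<a) tt)) (<ᵇ⇒< a x (subst T (sym a<x) tt)))

agree-above : ∀ a b x y → b < y → agree a b x y ≡ (a <ᵇ x)
agree-above a b x y b<y rewrite <ᵇ≡true b<y | <ᵇ≡false (<⇒≯ b<y) with x <ᵇ a in x<a | a <ᵇ x in a<x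
... | false | false = refl
... | false | true = refl
... | true | false = refl
... | true | true = ⊥-elim (<⇒≯ (<ᵇ⇒< x a (subst T (sym x<a) tt)) (<ᵇ⇒< a x (subst T (sym a<x) tt)))

Above : List ℕ → List ℕ → Set
Above A B = All (λ x → All (_< x) B) A

Below : List ℕ → List ℕ → Set
Below A B = All (λ x → All (x <_) B) A

above? : List ℕ → List ℕ → Bool
above? σ₁ σ₂ = all (λ x → all (λ y → y <ᵇ x) σ₂) σ₁

below? : List ℕ → List ℕ → Bool
below? σ₁ σ₂ = all (λ x → all (λ y → x <ᵇ y) σ₂) σ₁

agreeAll-below : ∀ a b σ s → length σ ≡ length s → All (_< b) s → agreeAll a b σ s ≡ all (_<ᵇ a) σ
agreeAll-below a b [] [] _ _ = refl
agreeAll-below a b (x ∷ σ) (y ∷ s) e (y<b ∷ s<b) =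
  cong₂ _∧_ (agree-below a b x y y<b) (agreeAll-below a b σ s (suc-injective e) s<b)

agreeAll-above : ∀ a b σ s → length σ ≡ length s → All (b <_) s → agreeAll a b σ s ≡ all (a <ᵇ_) σ
agreeAll-above a b [] [] _ _ = refl
agreeAll-above a b (x ∷ σ) (y ∷ s) e (b<y ∷ b<s) =
  cong₂ _∧_ (agree-above a b x y b<y) (agreeAll-above a b σ s (suc-injective e) b<s)

crossAgree-Above : ∀ σ₁ s₁ σ₂ s₂ → length σ₁ ≡ length s₁ → length σ₂ ≡ length s₂ → Above s₁ s₂ →
                   crossAgree σ₁ s₁ σ₂ s₂ ≡ above? σ₁ σ₂
crossAgree-Above [] [] σ₂ s₂ _ _ _ = refl
crossAgree-Above (a ∷ σ₁) (b ∷ s₁) σ₂ s₂ e₁ e₂ (s₂<b ∷ above) =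
  cong₂ _∧_ (agreeAll-below a b σ₂ s₂ e₂ s₂<b) (crossAgree-Above σ₁ s₁ σ₂ s₂ (suc-injective e₁) e₂ above)

crossAgree-Below : ∀ σ₁ s₁ σ₂ s₂ → length σ₁ ≡ length s₁ → length σ₂ ≡ length s₂ → Below s₁ s₂ →
                   crossAgree σ₁ s₁ σ₂ s₂ ≡ below? σ₁ σ₂
crossAgree-Below [] [] σ₂ s₂ _ _ _ = refl
crossAgree-Below (a ∷ σ₁) (b ∷ s₁) σ₂ s₂ e₁ e₂ (b<s₂ ∷ below) =
  cong₂ _∧_ (agreeAll-above a b σ₂ s₂ e₂ b<s₂) (crossAgree-Below σ₁ s₁ σ₂ s₂ (suc-injective e₁) e₂ below)

⊆-++⁻ : ∀ (A : List ℕ) {B s} → s ⊆ A ++ B → ∃₂ λ s₁ s₂ → s ≡ s₁ ++ s₂ × s₁ ⊆ A × s₂ ⊆ B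
⊆-++⁻ [] p = [] , _ , refl , [] , p
⊆-++⁻ (x ∷ A) (.x ∷ʳ p) with ⊆-++⁻ A p
... | s₁ , s₂ , refl , p₁ , p₂ = s₁ , s₂ , refl , x ∷ʳ p₁ , p₂
⊆-++⁻ (x ∷ A) (refl ∷ p) with ⊆-++⁻ A p
... | s₁ , s₂ , refl , p₁ , p₂ = x ∷ s₁ , s₂ , refl , refl ∷ p₁ , p₂

splitAtLengths : ∀ (σ : List ℕ) n m → length σ ≡ n + m →
                 ∃₂ λ σ₁ σ₂ → σ ≡ σ₁ ++ σ₂ × length σ₁ ≡ n × length σ₂ ≡ m
splitAtLengths σ zero m e = [] , σ , refl , refl , e
splitAtLengths (x ∷ σ) (suc n) m e with splitAtLengths σ n m (suc-injective e)
... | σ₁ , σ₂ , refl , e₁ , e₂ = x ∷ σ₁ , σ₂ , refl , cong suc e₁ , e₂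

record Cut (A B σ : List ℕ) : Set where
  field
    σ₁ σ₂ s₁ s₂ : List ℕ
    σ≡         : σ ≡ σ₁ ++ σ₂
    s₁⊆A       : s₁ ⊆ A
    s₂⊆B       : s₂ ⊆ B
    length₁    : length σ₁ ≡ length s₁
    length₂    : length σ₂ ≡ length s₂
    order₁     : T (sameOrder σ₁ s₁)
    order₂     : T (sameOrder σ₂ s₂)
    cross      : T (crossAgree σ₁ s₁ σ₂ s₂)

  contains₁ : Contains A σ₁
  contains₁ = occ s₁⊆A order₁

  contains₂ : Contains B σ₂
  contains₂ = occ s₂⊆B order₂

cut : ∀ A B σ → Contains (A ++ B) σ → Cut A B σ
cut A B σ (occ s⊆ o) with ⊆-++⁻ A {B} s⊆
... | s₁ , s₂ , refl , s₁⊆A , s₂⊆B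
  with splitAtLengths σ (length s₁) (length s₂) (trans (sameOrder⇒length≡ σ _ o) (length-++ s₁))
... | σ₁ , σ₂ , refl , e₁ , e₂
  with to (T-∧ {sameOrder σ₁ s₁ ∧ sameOrder σ₂ s₂}) (subst T (sameOrder-++ σ₁ s₁ σ₂ s₂ e₁) o)
... | o₁₂ , c with to (T-∧ {sameOrder σ₁ s₁}) o₁₂
... | o₁ , o₂ = record
  { σ₁ = σ₁ ; σ₂ = σ₂ ; s₁ = s₁ ; s₂ = s₂ ; σ≡ = refl ; s₁⊆A = s₁⊆A ; s₂⊆B = s₂⊆B
  ; length₁ = e₁ ; length₂ = e₂ ; order₁ = o₁ ; order₂ = o₂ ; cross = c }

Contains-++ʳ : ∀ {π} X Y → Contains π (X ++ Y) → Contains π Y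
Contains-++ʳ X Y (occ {s} s⊆π o)
  with splitAtLengths s (length X) (length Y) (trans (sym (sameOrder⇒length≡ (X ++ Y) s o)) (length-++ X))
... | s₁ , s₂ , refl , e₁ , _ =
  occ (⊆-trans (++⁺ˡ s₁ ⊆-refl) s⊆π) $
  proj₂ (to (T-∧ {sameOrder X s₁}) (proj₁ (to (T-∧ {sameOrder X s₁ ∧ sameOrder Y s₂})
    (subst T (sameOrder-++ X s₁ Y s₂ (sym e₁)) o))))

Above-⊆ : ∀ {s₁ A s₂ B} → s₁ ⊆ A → s₂ ⊆ B → Above A B → Above s₁ s₂
Above-⊆ s₁⊆A s₂⊆B = All-resp-⊆ s₁⊆A ∘ All.map (All-resp-⊆ s₂⊆B)

Below-⊆ : ∀ {s₁ A s₂ B} → s₁ ⊆ A → s₂ ⊆ B → Below A B → Below s₁ s₂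
Below-⊆ s₁⊆A s₂⊆B = All-resp-⊆ s₁⊆A ∘ All.map (All-resp-⊆ s₂⊆B)

Split : (List ℕ → List ℕ → Bool) → List ℕ → List ℕ → List ℕ → Set
Split rel A B σ = ∃₂ λ σ₁ σ₂ → σ ≡ σ₁ ++ σ₂ × T (rel σ₁ σ₂) × Contains A σ₁ × Contains B σ₂

split-Above : ∀ {A B σ} → Above A B → Contains (A ++ B) σ → Split above? A B σ
split-Above {A} {B} {σ} A>B c =
  σ₁ , σ₂ , σ≡ , subst T (crossAgree-Above σ₁ s₁ σ₂ s₂ length₁ length₂ (Above-⊆ s₁⊆A s₂⊆B A>B)) cross ,
  contains₁ , contains₂
  where open Cut (cut A B σ c)

split-Below : ∀ {A B σ} → Below A B → Contains (A ++ B) σ → Split below? A B σ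
split-Below {A} {B} {σ} A<B c =
  σ₁ , σ₂ , σ≡ , subst T (crossAgree-Below σ₁ s₁ σ₂ s₂ length₁ length₂ (Below-⊆ s₁⊆A s₂⊆B A<B)) cross ,
  contains₁ , contains₂
  where open Cut (cut A B σ c)

join-Above : ∀ {A B σ₁ σ₂} → Above A B → T (above? σ₁ σ₂) → Contains A σ₁ → Contains B σ₂ →
             Contains (A ++ B) (σ₁ ++ σ₂)
join-Above {σ₁ = σ₁} {σ₂} A>B σ₁>σ₂ (occ {s₁} s₁⊆A o₁) (occ {s₂} s₂⊆B o₂) =
  occ (++⁺ s₁⊆A s₂⊆B) (subst T (sym order≡) (from T-∧ (from T-∧ (o₁ , o₂) , σ₁>σ₂)))
  where
  e₁ = sameOrder⇒length≡ σ₁ s₁ o₁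
  e₂ = sameOrder⇒length≡ σ₂ s₂ o₂
  order≡ : sameOrder (σ₁ ++ σ₂) (s₁ ++ s₂) ≡ (sameOrder σ₁ s₁ ∧ sameOrder σ₂ s₂) ∧ above? σ₁ σ₂
  order≡ = trans (sameOrder-++ σ₁ s₁ σ₂ s₂ e₁)
                 (cong ((sameOrder σ₁ s₁ ∧ sameOrder σ₂ s₂) ∧_) (crossAgree-Above σ₁ s₁ σ₂ s₂ e₁ e₂ (Above-⊆ s₁⊆A s₂⊆B A>B)))

-- Monotone lists and runs

Decreasing : List ℕ → Set
Decreasing = AllPairs _>_

Increasing : List ℕ → Set
Increasing = AllPairs _<_

AllPairs-resp-⊆ : ∀ {R : ℕ → ℕ → Set} {s π} → s ⊆ π → AllPairs R π → AllPairs R s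
AllPairs-resp-⊆ [] [] = []
AllPairs-resp-⊆ (_ ∷ʳ p) (_ ∷ h) = AllPairs-resp-⊆ p h
AllPairs-resp-⊆ (refl ∷ p) (a ∷ h) = All-resp-⊆ p a ∷ AllPairs-resp-⊆ p h

Decreasing⇒Unique : ∀ {π} → Decreasing π → Unique π
Decreasing⇒Unique = AllPairs.map >⇒≢

Increasing⇒Unique : ∀ {π} → Increasing π → Unique π
Increasing⇒Unique = AllPairs.map <⇒≢

all<ᵇ⇒All : ∀ a σ → T (all (_<ᵇ a) σ) → All (_< a) σ
all<ᵇ⇒All a σ = All.map (<ᵇ⇒< _ a) ∘ Allₚ.all⁺ (_<ᵇ a) σ

all>ᵇ⇒All : ∀ a σ → T (all (a <ᵇ_) σ) → All (a <_) σ
all>ᵇ⇒All a σ = All.map (<ᵇ⇒< a _) ∘ Allₚ.all⁺ (a <ᵇ_) σ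

sameOrder-Decreasing : ∀ σ s → T (sameOrder σ s) → Decreasing s → Decreasing σ
sameOrder-Decreasing [] [] _ [] = []
sameOrder-Decreasing (a ∷ σ) (b ∷ s) o (s<b ∷ d) =
  all<ᵇ⇒All a σ (subst T (agreeAll-below a b σ s (sameOrder⇒length≡ σ s o′) s<b) (sameOrder-head {a} {b} {σ} {s} o)) ∷
  sameOrder-Decreasing σ s o′ d
  where o′ = sameOrder-tail {a} {b} {σ} {s} o

sameOrder-Increasing : ∀ σ s → T (sameOrder σ s) → Increasing s → Increasing σ
sameOrder-Increasing [] [] _ [] = []
sameOrder-Increasing (a ∷ σ) (b ∷ s) o (b<s ∷ i) =
  all>ᵇ⇒All a σ (subst T (agreeAll-above a b σ s (sameOrder⇒length≡ σ s o′) b<s) (sameOrder-head {a} {b} {σ} {s} o)) ∷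
  sameOrder-Increasing σ s o′ i
  where o′ = sameOrder-tail {a} {b} {σ} {s} o

Contains-Decreasing : ∀ {A σ} → Decreasing A → Contains A σ → Decreasing σ
Contains-Decreasing d (occ {s} s⊆A o) = sameOrder-Decreasing _ s o (AllPairs-resp-⊆ s⊆A d)

Contains-Increasing : ∀ {A σ} → Increasing A → Contains A σ → Increasing σ
Contains-Increasing i (occ {s} s⊆A o) = sameOrder-Increasing _ s o (AllPairs-resp-⊆ s⊆A i)

Decreasing⇒sameOrder : ∀ σ s → Decreasing σ → Decreasing s → length σ ≡ length s → T (sameOrder σ s)
Decreasing⇒sameOrder [] [] _ _ _ = tt
Decreasing⇒sameOrder (a ∷ σ) (b ∷ s) (σ<a ∷ dσ) (s<b ∷ ds) e =
  sameOrder-cons {a} {b} {σ} {s}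
    (subst T (sym (agreeAll-below a b σ s (suc-injective e) s<b)) (Allₚ.all⁻ (_<ᵇ a) (All.map <⇒<ᵇ σ<a)))
    (Decreasing⇒sameOrder σ s dσ ds (suc-injective e))

Contains-length : ∀ {A σ} → Contains A σ → length σ ≤ length A
Contains-length {σ = σ} (occ {s} s⊆A o) = subst (_≤ _) (sym (sameOrder⇒length≡ σ s o)) (length-mono-≤ s⊆A)

Contains-[] : ∀ A → Contains A []
Contains-[] A = occ ([]⊆-universal A) tt

noAscent⇒Decreasing : ∀ π → Unique π → (∀ x y → x ∷ y ∷ [] ⊆ π → ¬ x < y) → Decreasing π
noAscent⇒Decreasing [] [] _ = []
noAscent⇒Decreasing (x ∷ π) (x∉π ∷ u) noAsc =
  All.tabulate (λ y∈π → ≤∧≢⇒< (≮⇒≥ (noAsc x _ (refl ∷ from∈ y∈π))) (λ e → All.lookup x∉π y∈π (sym e))) ∷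
  noAscent⇒Decreasing π u (λ a b p → noAsc a b (x ∷ʳ p))

noDescent⇒Increasing : ∀ π → Unique π → (∀ x y → x ∷ y ∷ [] ⊆ π → ¬ y < x) → Increasing π
noDescent⇒Increasing [] [] _ = []
noDescent⇒Increasing (x ∷ π) (x∉π ∷ u) noDesc =
  All.tabulate (λ y∈π → ≤∧≢⇒< (≮⇒≥ (noDesc x _ (refl ∷ from∈ y∈π))) (All.lookup x∉π y∈π)) ∷
  noDescent⇒Increasing π u (λ a b p → noDesc a b (x ∷ʳ p))

length-mid : ∀ {A : Set} (ys₁ : List A) x ys₂ → length (ys₁ ++ x ∷ ys₂) ≡ suc (length (ys₁ ++ ys₂))
length-mid [] x ys₂ = refl
length-mid (y ∷ ys₁) x ys₂ = cong suc (length-mid ys₁ x ys₂)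

∈-mid⁻ : ∀ {A : Set} (ys₁ : List A) {ys₂ x z} → z ∈ ys₁ ++ x ∷ ys₂ → x ≢ z → z ∈ ys₁ ++ ys₂
∈-mid⁻ ys₁ p x≢z with ∈-++⁻ ys₁ p
... | inj₁ q = ∈-++⁺ˡ q
... | inj₂ (here refl) = ⊥-elim (x≢z refl)
... | inj₂ (there q) = ∈-++⁺ʳ ys₁ q

Unique-⊆ˢ⇒length≤ : ∀ {A : Set} (xs ys : List A) → Unique xs → xs ⊆ˢ ys → length xs ≤ length ys
Unique-⊆ˢ⇒length≤ [] ys _ _ = z≤n
Unique-⊆ˢ⇒length≤ (x ∷ xs) ys (x∉xs ∷ u) xs⊆ys with ∈-∃++ (xs⊆ys (here refl))
... | ys₁ , ys₂ , refl =
  subst (suc (length xs) ≤_) (sym (length-mid ys₁ x ys₂))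
    (s≤s (Unique-⊆ˢ⇒length≤ xs (ys₁ ++ ys₂) u (λ z∈ → ∈-mid⁻ ys₁ (xs⊆ys (there z∈)) (All.lookup x∉xs z∈))))

Unique-⊆ˢ⇒length≡ : ∀ {A : Set} (xs ys : List A) → Unique xs → Unique ys → xs ⊆ˢ ys → ys ⊆ˢ xs → length xs ≡ length ys
Unique-⊆ˢ⇒length≡ xs ys u v p q = ≤-antisym (Unique-⊆ˢ⇒length≤ xs ys u p) (Unique-⊆ˢ⇒length≤ ys xs v q)

open DecMembership _≟_ using (_∈?_)

Unique-⊆ˢ⇒⊇ˢ : ∀ π S → Unique π → π ⊆ˢ S → length S ≤ length π → S ⊆ˢ π
Unique-⊆ˢ⇒⊇ˢ π S u π⊆S |S|≤|π| {v} v∈S with v ∈? π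
... | yes v∈π = v∈π
... | no v∉π with ∈-∃++ v∈S
...   | S₁ , S₂ , refl = ⊥-elim (1+n≰n (≤-trans (subst (_≤ length π) (length-mid S₁ v S₂) |S|≤|π|)
        (Unique-⊆ˢ⇒length≤ π (S₁ ++ S₂) u (λ z∈π → ∈-mid⁻ S₁ (π⊆S z∈π) (λ { refl → v∉π z∈π })))))

InRange : ℕ → ℕ → ℕ → Set
InRange j a v = j < v × v ≤ j + a

decRun : ℕ → ℕ → List ℕ
decRun j zero = []
decRun j (suc a) = suc (j + a) ∷ decRun j a

incRun : ℕ → ℕ → List ℕ
incRun j zero = []
incRun j (suc a) = suc j ∷ incRun (suc j) a

length-decRun : ∀ j a → length (decRun j a) ≡ a
length-decRun j zero = refl
length-decRun j (suc a) = cong suc (length-decRun j a)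

length-incRun : ∀ j a → length (incRun j a) ≡ a
length-incRun j zero = refl
length-incRun j (suc a) = cong suc (length-incRun (suc j) a)

∈-decRun⁻ : ∀ j a {v} → v ∈ decRun j a → InRange j a v
∈-decRun⁻ j (suc a) (here refl) = s≤s (m≤m+n j a) , ≤-reflexive (sym (+-suc j a))
∈-decRun⁻ j (suc a) (there p) with ∈-decRun⁻ j a p
... | j<v , v≤j+a = j<v , ≤-trans v≤j+a (+-monoʳ-≤ j (n≤1+n a))

∈-decRun⁺ : ∀ j a {v} → InRange j a v → v ∈ decRun j a
∈-decRun⁺ j zero {v} (j<v , v≤j) = ⊥-elim (<⇒≱ j<v (subst (v ≤_) (+-identityʳ j) v≤j))
∈-decRun⁺ j (suc a) {v} (j<v , v≤j+1+a) with v ≟ suc (j + a)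
... | yes refl = here refl
... | no v≢ = there (∈-decRun⁺ j a (j<v , ≤-pred (≤∧≢⇒< (subst (v ≤_) (+-suc j a) v≤j+1+a) v≢)))

∈-incRun⁻ : ∀ j a {v} → v ∈ incRun j a → InRange j a v
∈-incRun⁻ j (suc a) (here refl) = ≤-refl , subst (suc j ≤_) (sym (+-suc j a)) (s≤s (m≤m+n j a))
∈-incRun⁻ j (suc a) {v} (there p) with ∈-incRun⁻ (suc j) a p
... | j<v , v≤ = <⇒≤ j<v , subst (v ≤_) (sym (+-suc j a)) v≤

∈-incRun⁺ : ∀ j a {v} → InRange j a v → v ∈ incRun j a
∈-incRun⁺ j zero {v} (j<v , v≤j) = ⊥-elim (<⇒≱ j<v (subst (v ≤_) (+-identityʳ j) v≤j))
∈-incRun⁺ j (suc a) {v} (j<v , v≤j+1+a) with v ≟ suc j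
... | yes refl = here refl
... | no v≢ = there (∈-incRun⁺ (suc j) a (≤∧≢⇒< j<v (v≢ ∘ sym) , subst (v ≤_) (+-suc j a) v≤j+1+a))

decRun-Decreasing : ∀ j a → Decreasing (decRun j a)
decRun-Decreasing j zero = []
decRun-Decreasing j (suc a) = All.tabulate (s≤s ∘ proj₂ ∘ ∈-decRun⁻ j a) ∷ decRun-Decreasing j a

incRun-Increasing : ∀ j a → Increasing (incRun j a)
incRun-Increasing j zero = []
incRun-Increasing j (suc a) = All.tabulate (proj₁ ∘ ∈-incRun⁻ (suc j) a) ∷ incRun-Increasing (suc j) a

decRun-unique : ∀ j a α → Decreasing α → length α ≡ a → All (InRange j a) α → α ≡ decRun j a
decRun-unique j zero [] _ _ _ = refl
decRun-unique j (suc a) (x ∷ α) d@(α<x ∷ dα) e (x∈ ∷ α∈)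
  with Unique-⊆ˢ⇒⊇ˢ (x ∷ α) (decRun j (suc a)) (Decreasing⇒Unique d) (∈-decRun⁺ j (suc a) ∘ All.lookup (x∈ ∷ α∈))
         (≤-reflexive (trans (length-decRun j (suc a)) (sym e))) (here refl)
... | there top∈α = ⊥-elim (<⇒≱ (All.lookup α<x top∈α) (subst (x ≤_) (+-suc j a) (proj₂ x∈)))
... | here refl = cong (suc (j + a) ∷_)
  (decRun-unique j a α dα (suc-injective e) (All.zipWith (λ (v<x , j<v , _) → j<v , ≤-pred v<x) (α<x , α∈)))

incRun-unique : ∀ j a α → Increasing α → length α ≡ a → All (InRange j a) α → α ≡ incRun j a
incRun-unique j zero [] _ _ _ = refl
incRun-unique j (suc a) (x ∷ α) i@(x<α ∷ iα) e (x∈ ∷ α∈)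
  with Unique-⊆ˢ⇒⊇ˢ (x ∷ α) (incRun j (suc a)) (Increasing⇒Unique i) (∈-incRun⁺ j (suc a) ∘ All.lookup (x∈ ∷ α∈))
         (≤-reflexive (trans (length-incRun j (suc a)) (sym e))) (here refl)
... | there bottom∈α = ⊥-elim (<⇒≱ (All.lookup x<α bottom∈α) (proj₁ x∈))
... | here refl = cong (suc j ∷_)
  (incRun-unique (suc j) a α iα (suc-injective e)
    (All.zipWith (λ {v} (x<v , _ , v≤) → x<v , subst (v ≤_) (+-suc j a) v≤) (x<α , α∈)))

j+[t+r]≡j+r+t : ∀ j t r → j + (t + r) ≡ j + r + t
j+[t+r]≡j+r+t j t r = trans (cong (j +_) (+-comm t r)) (sym (+-assoc j r t))

decRun-+ : ∀ j t r → decRun j (t + r) ≡ decRun (j + r) t ++ decRun j r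
decRun-+ j zero r = refl
decRun-+ j (suc t) r = cong₂ _∷_ (cong suc (j+[t+r]≡j+r+t j t r)) (decRun-+ j t r)

decRun≡++ : ∀ j N σ w → decRun j N ≡ σ ++ w → ∃₂ λ t r → t + r ≡ N × σ ≡ decRun (j + r) t × w ≡ decRun j r
decRun≡++ j N [] w eq = 0 , N , refl , refl , sym eq
decRun≡++ j (suc N) (x ∷ σ) w eq with ∷-injective eq
... | refl , eq′ with decRun≡++ j N σ w eq′
... | t , r , refl , refl , refl = suc t , r , refl , cong (λ v → suc v ∷ decRun (j + r) t) (j+[t+r]≡j+r+t j t r) , refl

-- From here on patterns are indexed by e = k − 3: ω′ e is ω_{3+e}.
ω′ : ℕ → List ℕ
ω′ e = decRun 3 e ++ 2 ∷ 1 ∷ 3 ∷ []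

ω≡ω′ : ∀ e → ω (3 + e) ≡ ω′ e
ω≡ω′ e = cong (_++ 2 ∷ 1 ∷ 3 ∷ []) (descTo4≡decRun e)
  where
  descTo4≡decRun : ∀ e → descTo4 (3 + e) ≡ decRun 3 e
  descTo4≡decRun zero = refl
  descTo4≡decRun (suc e) = cong (suc (3 + e) ∷_) (descTo4≡decRun e)

ω′-+ : ∀ d e → ω′ (d + e) ≡ decRun (3 + e) d ++ ω′ e
ω′-+ d e = trans (cong (_++ 2 ∷ 1 ∷ 3 ∷ []) (decRun-+ 3 d e)) (++-assoc (decRun (3 + e) d) (decRun 3 e) _)

Contains-ω′-mono : ∀ {π} d e → Contains π (ω′ (d + e)) → Contains π (ω′ e)
Contains-ω′-mono d e = Contains-++ʳ (decRun (3 + e) d) (ω′ e) ∘ subst (Contains _) (ω′-+ d e)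

-- Permutations and pattern avoidance

Unique-concatMap⁺ : ∀ {A B : Set} (f : A → List B) xs → Unique xs → (∀ {x} → x ∈ xs → Unique (f x)) →
                    (∀ {x y z} → x ∈ xs → y ∈ xs → z ∈ f x → z ∈ f y → x ≡ y) → Unique (concatMap f xs)
Unique-concatMap⁺ f [] _ _ _ = []
Unique-concatMap⁺ f (x ∷ xs) (x∉xs ∷ u) uf disjoint =
  Uniqueₚ.++⁺ (uf (here refl)) (Unique-concatMap⁺ f xs u (uf ∘ there) (λ p q → disjoint (there p) (there q)))
    (λ (z∈fx , z∈rest) → let (y , y∈xs , z∈fy) = find (∈-concatMap⁻ f {xs = xs} z∈rest)
                          in All.lookup x∉xs y∈xs (disjoint (here refl) (there y∈xs) z∈fx z∈fy))

IsPerm : ℕ → List ℕ → Set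
IsPerm n π = Unique π × All (InRange 0 n) π × length π ≡ n

∈-1…m⁻ : ∀ {m v} → v ∈ map suc (upTo m) → InRange 0 m v
∈-1…m⁻ {m} p with ∈-map⁻ suc p
... | i , i∈ , refl = s≤s z≤n , ∈-upTo⁻ i∈

∈-1…m⁺ : ∀ {m v} → InRange 0 m v → v ∈ map suc (upTo m)
∈-1…m⁺ {v = suc v} (_ , v<m) = ∈-map⁺ suc (∈-upTo⁺ v<m)

∈-allLists⁻ : ∀ n m {π} → π ∈ allLists n m → length π ≡ n × All (InRange 0 m) π
∈-allLists⁻ zero m (here refl) = refl , []
∈-allLists⁻ (suc n) m p with find (∈-concatMap⁻ (λ x → map (x ∷_) (allLists n m)) {xs = map suc (upTo m)} p)
... | x , x∈ , q with ∈-map⁻ (x ∷_) q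
... | π , π∈ , refl with ∈-allLists⁻ n m π∈
... | e , r = cong suc e , ∈-1…m⁻ x∈ ∷ r

∈-allLists⁺ : ∀ n m {π} → length π ≡ n → All (InRange 0 m) π → π ∈ allLists n m
∈-allLists⁺ zero m {[]} _ _ = here refl
∈-allLists⁺ (suc n) m {x ∷ π} e (x∈ ∷ r) =
  ∈-concatMap⁺ (λ y → map (y ∷_) (allLists n m)) {xs = map suc (upTo m)}
    (lose (∈-1…m⁺ x∈) (∈-map⁺ (x ∷_) (∈-allLists⁺ n m (suc-injective e) r)))

allLists-Unique : ∀ n m → Unique (allLists n m)
allLists-Unique zero m = [] ∷ []
allLists-Unique (suc n) m =
  Unique-concatMap⁺ _ (map suc (upTo m)) (Uniqueₚ.map⁺ suc-injective (Uniqueₚ.upTo⁺ m))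
    (λ _ → Uniqueₚ.map⁺ ∷-injectiveʳ (allLists-Unique n m)) sameHead
  where
  sameHead : ∀ {x y z} → _ → _ → z ∈ map (x ∷_) (allLists n m) → z ∈ map (y ∷_) (allLists n m) → x ≡ y
  sameHead _ _ p q with ∈-map⁻ _ p | ∈-map⁻ _ q
  ... | _ , _ , refl | _ , _ , refl = refl

notElem⇔All≢ : ∀ x ys → T (notElem x ys) ⇔ All (x ≢_) ys
notElem⇔All≢ x ys = mk⇔ (All.map (λ {y} t → to T-not t ∘ ≡⇒≡ᵇ x y) ∘ Allₚ.all⁺ _ ys)
                        (Allₚ.all⁻ _ ∘ All.map (λ {y} x≢y → from T-not (x≢y ∘ ≡ᵇ⇒≡ x y)))

distinct⇔Unique : ∀ xs → T (distinct xs) ⇔ Unique xs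
distinct⇔Unique [] = mk⇔ (λ _ → []) (λ _ → tt)
distinct⇔Unique (x ∷ xs) =
  mk⇔ (λ t → let (h , d) = to (T-∧ {notElem x xs}) t in to (notElem⇔All≢ x xs) h ∷ to (distinct⇔Unique xs) d)
      (λ { (x∉xs ∷ u) → from T-∧ (from (notElem⇔All≢ x xs) x∉xs , from (distinct⇔Unique xs) u) })

∈-Sn⇔IsPerm : ∀ n π → π ∈ Sn n ⇔ IsPerm n π
∈-Sn⇔IsPerm n π = mk⇔
  (λ p → let (π∈ , d) = ∈-filter⁻ (T? ∘ distinct) {xs = allLists n n} p
             (e , r) = ∈-allLists⁻ n n π∈
         in to (distinct⇔Unique π) d , r , e)
  (λ (u , r , e) → ∈-filter⁺ (T? ∘ distinct) (∈-allLists⁺ n n e r) (from (distinct⇔Unique π) u))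

Sn-Unique : ∀ n → Unique (Sn n)
Sn-Unique n = Uniqueₚ.filter⁺ (T? ∘ distinct) (allLists-Unique n n)

Avoids : ℕ → List ℕ → Set
Avoids e π = ¬ Contains π p132 × ¬ Contains π p2341 × ¬ Contains π (ω′ e)

avoidsAll : ℕ → List ℕ → Bool
avoidsAll k π = avoids π p132 ∧ avoids π p2341 ∧ avoids π (ω k)

avoiders : ℕ → ℕ → List (List ℕ)
avoiders k n = filter (T? ∘ avoidsAll k) (Sn n)

avoidsAll⇔Avoids : ∀ e π → T (avoidsAll (3 + e) π) ⇔ Avoids e π
avoidsAll⇔Avoids e π = mk⇔
  (λ t → let (a₁ , t′) = to (T-∧ {avoids π p132}) t
             (a₂ , a₃) = to (T-∧ {avoids π p2341}) t′
         in to (avoids⇔¬Contains π p132) a₁ , to (avoids⇔¬Contains π p2341) a₂ ,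
            subst (λ σ → ¬ Contains π σ) (ω≡ω′ e) (to (avoids⇔¬Contains π (ω (3 + e))) a₃))
  (λ (¬c₁ , ¬c₂ , ¬c₃) → from T-∧ (from (avoids⇔¬Contains π p132) ¬c₁ ,
     from T-∧ (from (avoids⇔¬Contains π p2341) ¬c₂ ,
     from (avoids⇔¬Contains π (ω (3 + e))) (subst (λ σ → ¬ Contains π σ) (sym (ω≡ω′ e)) ¬c₃))))

∈-avoiders⇔ : ∀ e n π → π ∈ avoiders (3 + e) n ⇔ (IsPerm n π × Avoids e π)
∈-avoiders⇔ e n π = mk⇔
  (λ p → let (π∈ , t) = ∈-filter⁻ (T? ∘ avoidsAll (3 + e)) {xs = Sn n} p
         in to (∈-Sn⇔IsPerm n π) π∈ , to (avoidsAll⇔Avoids e π) t)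
  (λ (perm , av) → ∈-filter⁺ (T? ∘ avoidsAll (3 + e)) (from (∈-Sn⇔IsPerm n π) perm) (from (avoidsAll⇔Avoids e π) av))

avoiders-Unique : ∀ k n → Unique (avoiders k n)
avoiders-Unique k n = Uniqueₚ.filter⁺ (T? ∘ avoidsAll k) (Sn-Unique n)

-- Splitting a permutation at its maximum

DecThenMax : List ℕ → Set
DecThenMax σ = Decreasing σ ⊎ ∃₂ λ σ′ x → σ ≡ σ′ ++ [ x ] × Decreasing σ′ × All (_< x) σ′

¬DecThenMax : ∀ xs y → ¬ Decreasing (xs ++ [ y ]) → (Decreasing xs → ¬ All (_< y) xs) → ¬ DecThenMax (xs ++ [ y ])
¬DecThenMax xs y ¬d _ (inj₁ d) = ¬d d
¬DecThenMax xs y _ ¬dm (inj₂ (σ′ , x , eq , d , σ′<x)) with ∷ʳ-injective σ′ xs (sym eq)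
... | refl , refl = ¬dm d σ′<x

Contains-[_] : ∀ n σ → Contains [ n ] σ → σ ≡ [] ⊎ ∃ λ x → σ ≡ [ x ]
Contains-[ n ] [] _ = inj₁ refl
Contains-[ n ] (x ∷ []) _ = inj₂ (x , refl)
Contains-[ n ] (x ∷ y ∷ σ) c with Contains-length {[ n ]} {x ∷ y ∷ σ} c
... | s≤s ()

All<⇒Below : ∀ {α n} → All (_< n) α → Below α [ n ]
All<⇒Below = All.map (_∷ [])

below?-[_] : ∀ x σ → T (below? σ [ x ]) → All (_< x) σ
below?-[ x ] σ = All.map (λ t → <ᵇ⇒< _ x (proj₁ (to (T-∧ {_ <ᵇ x}) t))) ∘ Allₚ.all⁺ _ σ

Contains-DecThenMax : ∀ {D n σ} → Decreasing D → All (_< n) D → Contains (D ++ [ n ]) σ → DecThenMax σ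
Contains-DecThenMax {D} {n} {σ} d D<n c with split-Below {D} {[ n ]} {σ} (All<⇒Below D<n) c
... | σ₁ , σ₂ , refl , σ₁<σ₂ , c₁ , c₂ with Contains-[ n ] σ₂ c₂
... | inj₁ refl = inj₁ (subst Decreasing (sym (++-identityʳ σ₁)) (Contains-Decreasing d c₁))
... | inj₂ (x , refl) = inj₂ (σ₁ , x , refl , Contains-Decreasing d c₁ , below?-[ x ] σ₁ σ₁<σ₂)

Contains-++-max⁻ : ∀ {α n} τ y → All (_< n) α → ¬ T (below? τ [ y ]) →
                   Contains (α ++ [ n ]) (τ ++ [ y ]) → Contains α (τ ++ [ y ])
Contains-++-max⁻ {α} {n} τ y α<n τ≮y c with split-Below {α} {[ n ]} {τ ++ [ y ]} (All<⇒Below α<n) c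
... | σ₁ , σ₂ , eq , σ₁<σ₂ , c₁ , c₂ with Contains-[ n ] σ₂ c₂
... | inj₁ refl = subst (Contains α) (trans (sym (++-identityʳ σ₁)) (sym eq)) c₁
... | inj₂ (x , refl) with ∷ʳ-injective τ σ₁ eq
... | refl , refl = ⊥-elim (τ≮y σ₁<σ₂)

213-occurrence : ∀ {x y n} → y < x → x < n → y < n → T (sameOrder (2 ∷ 1 ∷ 3 ∷ []) (x ∷ y ∷ n ∷ []))
213-occurrence y<x x<n y<n
  rewrite <ᵇ≡true y<x | <ᵇ≡true x<n | <ᵇ≡true y<n
        | <ᵇ≡false (<⇒≯ y<x) | <ᵇ≡false (<⇒≯ x<n) | <ᵇ≡false (<⇒≯ y<n) = tt

132-occurrence : ∀ {a b n} → a < b → b < n → a < n → T (sameOrder p132 (a ∷ n ∷ b ∷ []))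
132-occurrence a<b b<n a<n
  rewrite <ᵇ≡true a<b | <ᵇ≡true b<n | <ᵇ≡true a<n
        | <ᵇ≡false (<⇒≯ a<b) | <ᵇ≡false (<⇒≯ b<n) | <ᵇ≡false (<⇒≯ a<n) = tt

2341-occurrence : ∀ {x y n b} → b < x → x < y → y < n → T (sameOrder p2341 (x ∷ y ∷ n ∷ b ∷ []))
2341-occurrence b<x x<y y<n
  rewrite <ᵇ≡true b<x | <ᵇ≡true x<y | <ᵇ≡true y<n
        | <ᵇ≡false (<⇒≯ b<x) | <ᵇ≡false (<⇒≯ x<y) | <ᵇ≡false (<⇒≯ y<n)
        | <ᵇ≡true (<-trans b<x x<y) | <ᵇ≡false (<⇒≯ (<-trans b<x x<y))
        | <ᵇ≡true (<-trans x<y y<n) | <ᵇ≡false (<⇒≯ (<-trans x<y y<n))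
        | <ᵇ≡true (<-trans (<-trans b<x x<y) y<n) | <ᵇ≡false (<⇒≯ (<-trans (<-trans b<x x<y) y<n)) = tt

Avoids-⊆ : ∀ {e β π} → β ⊆ π → Avoids e π → Avoids e β
Avoids-⊆ {e} β⊆π (¬c₁ , ¬c₂ , ¬c₃) =
  ¬c₁ ∘ Contains-mono {σ = p132} β⊆π ,
  ¬c₂ ∘ Contains-mono {σ = p2341} β⊆π ,
  ¬c₃ ∘ Contains-mono {σ = ω′ e} β⊆π

-- For k ≥ 4 every pattern ends below its maximum, so an appended maximum is harmless.
Avoids-++-max⁺ : ∀ e α n → All (_< n) α → Avoids (suc e) α → Avoids (suc e) (α ++ [ n ])
Avoids-++-max⁺ e α n α<n (¬c₁ , ¬c₂ , ¬c₃) =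
  ¬c₁ ∘ Contains-++-max⁻ (1 ∷ 3 ∷ []) 2 α<n (λ ()) ,
  ¬c₂ ∘ Contains-++-max⁻ (2 ∷ 3 ∷ 4 ∷ []) 1 α<n (λ ()) ,
  ¬c₃ ∘ subst (Contains α) ω′-snoc ∘ Contains-++-max⁻ (decRun 3 (suc e) ++ 2 ∷ 1 ∷ []) 3 α<n (λ ())
      ∘ subst (Contains (α ++ [ n ])) (sym ω′-snoc)
  where
  ω′-snoc : (decRun 3 (suc e) ++ 2 ∷ 1 ∷ []) ++ [ 3 ] ≡ ω′ (suc e)
  ω′-snoc = ++-assoc (decRun 3 (suc e)) (2 ∷ 1 ∷ []) [ 3 ]

Increasing-++-max : ∀ α n → Increasing α → All (_< n) α → Increasing (α ++ [ n ])
Increasing-++-max [] n [] [] = [] ∷ []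
Increasing-++-max (x ∷ α) n (x<α ∷ iα) (x<n ∷ α<n) = Allₚ.++⁺ x<α (x<n ∷ []) ∷ Increasing-++-max α n iα α<n

Avoids₀-++-max⇒Increasing : ∀ α n → Unique α → All (_< n) α → Avoids 0 (α ++ [ n ]) → Increasing α
Avoids₀-++-max⇒Increasing α n u α<n (_ , _ , ¬c₃) =
  noDescent⇒Increasing α u (λ x y xy⊆α y<x →
    ¬c₃ (occ (++⁺ xy⊆α ⊆-refl) $
         213-occurrence y<x (All.lookup α<n (to∈ xy⊆α)) (All.lookup α<n (to∈ (∷ˡ⁻ xy⊆α)))))

Increasing⇒Avoids₀-++-max : ∀ α n → Increasing α → All (_< n) α → Avoids 0 (α ++ [ n ])
Increasing⇒Avoids₀-++-max α n iα α<n =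
  (λ c → case Contains-Increasing i c of λ { (_ ∷ (s≤s (s≤s ()) ∷ []) ∷ _) }) ,
  (λ c → case Contains-Increasing i c of λ { ((_ ∷ _ ∷ s≤s () ∷ []) ∷ _) }) ,
  (λ c → case Contains-Increasing i (Contains-++ʳ (decRun 3 0) _ c) of λ { ((s≤s () ∷ _) ∷ _) })
  where
  i = Increasing-++-max α n iα α<n

-- In π = decRun j a ++ n ∷ β, the block decRun j a ++ [ n ] can host the first budget e a entries of
-- ω_{3+e} = 3+e, …, 4, 2, 1, 3 (n hosting the only one when a = 0), leaving ω_{3 + residual e a} for β.
budget : ℕ → ℕ → ℕ
budget e a = e ⊓ (1 ⊔ a)

residual : ℕ → ℕ → ℕ
residual e a = e ∸ budget e a

budget+residual : ∀ e a → budget e a + residual e a ≡ e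
budget+residual e a = trans (+-comm (budget e a) _) (m∸n+n≡m (m⊓n≤m e (1 ⊔ a)))

decRun-in-block : ∀ j a n c t → All (_< n) (decRun j a) → t ≤ 1 ⊔ a → Contains (decRun j a ++ [ n ]) (decRun c t)
decRun-in-block j zero n c zero _ _ = Contains-[] _
decRun-in-block j zero n c (suc zero) _ _ = occ ⊆-refl tt
decRun-in-block j zero n c (suc (suc t)) _ (s≤s ())
decRun-in-block j (suc a) n c t _ t≤1+a = Contains-mono (++⁺ʳ [ n ] ⊆-refl) in-run
  where
  r = suc a ∸ t
  run≡ : decRun j (suc a) ≡ decRun (j + r) t ++ decRun j r
  run≡ = trans (cong (decRun j) (sym (m+[n∸m]≡n t≤1+a))) (decRun-+ j t r)
  in-run : Contains (decRun j (suc a)) (decRun c t)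
  in-run = occ (subst (decRun (j + r) t ⊆_) (sym run≡) (++⁺ʳ (decRun j r) ⊆-refl))
    (Decreasing⇒sameOrder (decRun c t) (decRun (j + r) t) (decRun-Decreasing c t) (decRun-Decreasing (j + r) t)
       (trans (length-decRun c t) (sym (length-decRun (j + r) t))))

decRun-in-block⇒≤ : ∀ j a n c t → All (_< n) (decRun j a) → Contains (decRun j a ++ [ n ]) (decRun c t) → t ≤ 1 ⊔ a
decRun-in-block⇒≤ j a n c t run<n occ′ with split-Below {decRun j a} {[ n ]} {decRun c t} (All<⇒Below run<n) occ′
... | σ₁ , σ₂ , eq , σ₁<σ₂ , c₁ , c₂ with Contains-[ n ] σ₂ c₂
... | inj₁ refl = begin
  t                    ≡⟨ sym (length-decRun c t) ⟩
  length (decRun c t)  ≡⟨ trans (cong length eq) (trans (length-++ σ₁) (+-identityʳ _)) ⟩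
  length σ₁            ≤⟨ Contains-length c₁ ⟩
  length (decRun j a)  ≡⟨ length-decRun j a ⟩
  a                    ≤⟨ m≤n⊔m 1 a ⟩
  1 ⊔ a                ∎
  where open ≤-Reasoning
... | inj₂ (x , refl) = lastOnly σ₁ eq (below?-[ x ] σ₁ σ₁<σ₂)
  where
  lastOnly : ∀ σ₁ → decRun c t ≡ σ₁ ++ [ x ] → All (_< x) σ₁ → t ≤ 1 ⊔ a
  lastOnly [] eq _ = ≤-trans (≤-reflexive (trans (sym (length-decRun c t)) (cong length eq))) (m≤m⊔n 1 a)
  lastOnly (y ∷ σ₁) eq (y<x ∷ _) with subst Decreasing eq (decRun-Decreasing c t)
  ... | rest<y ∷ _ = ⊥-elim (<-asym y<x (All.lookup rest<y (∈-++⁺ʳ σ₁ (here refl))))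

Above⇒above? : ∀ σ₁ σ₂ → Above σ₁ σ₂ → T (above? σ₁ σ₂)
Above⇒above? σ₁ σ₂ = Allₚ.all⁻ _ ∘ All.map (Allₚ.all⁻ _ ∘ All.map <⇒<ᵇ)

Above-threshold : ∀ {c xs ys} → All (c <_) xs → All (_≤ c) ys → Above xs ys
Above-threshold c<xs ys≤c = All.map (λ c<x → All.map (λ y≤c → ≤-<-trans y≤c c<x) ys≤c) c<xs

decRun-above-ω′ : ∀ r t → T (above? (decRun (3 + r) t) (ω′ r))
decRun-above-ω′ r t = Above⇒above? _ _ (Above-threshold {3 + r}
  (All.tabulate (proj₁ ∘ ∈-decRun⁻ (3 + r) t))
  (Allₚ.++⁺ (All.tabulate (proj₂ ∘ ∈-decRun⁻ 3 r)) (s≤s (s≤s z≤n) ∷ s≤s z≤n ∷ s≤s (s≤s (s≤s z≤n)) ∷ [])))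

above?-++⁻ʳ : ∀ xs ys zs → T (above? (xs ++ ys) zs) → T (above? ys zs)
above?-++⁻ʳ [] ys zs t = t
above?-++⁻ʳ (x ∷ xs) ys zs t = above?-++⁻ʳ xs ys zs (proj₂ (to (T-∧ {all (_<ᵇ x) zs}) t))

++≡++⁻ : ∀ (σ₁ σ₂ X Y : List ℕ) → σ₁ ++ σ₂ ≡ X ++ Y →
         (∃ λ w → X ≡ σ₁ ++ w × σ₂ ≡ w ++ Y) ⊎ (∃₂ λ z w → σ₁ ≡ X ++ z ∷ w × Y ≡ z ∷ w ++ σ₂)
++≡++⁻ [] σ₂ X Y eq = inj₁ (X , refl , eq)
++≡++⁻ (x ∷ σ₁) σ₂ [] Y eq = inj₂ (x , σ₁ , refl , sym eq)
++≡++⁻ (x ∷ σ₁) σ₂ (y ∷ X) Y eq with ∷-injective eq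
... | refl , eq′ with ++≡++⁻ σ₁ σ₂ X Y eq′
... | inj₁ (w , refl , refl) = inj₁ (w , refl , refl)
... | inj₂ (z , w , refl , refl) = inj₂ (z , w , refl , refl)

Avoids₀-block⇒≤1 : ∀ j a n β → All (_< n) (decRun j a) → Avoids 0 ((decRun j a ++ [ n ]) ++ β) → a ≤ 1
Avoids₀-block⇒≤1 j zero n β _ _ = z≤n
Avoids₀-block⇒≤1 j (suc zero) n β _ _ = s≤s z≤n
Avoids₀-block⇒≤1 j (suc (suc a)) n β (x<n ∷ y<n ∷ _) (_ , _ , ¬c₃) =
  ⊥-elim (¬c₃ (occ (++⁺ʳ β (refl ∷ refl ∷ ++⁺ˡ (decRun j a) ⊆-refl))
                   (213-occurrence (s≤s (≤-reflexive (sym (+-suc j a)))) x<n y<n)))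

module Block (j a n : ℕ) (β : List ℕ) (run<n : All (_< n) (decRun j a)) (block>β : Above (decRun j a ++ [ n ]) β) where

  block = decRun j a ++ [ n ]

  Avoids-block⁻ : ∀ e → Avoids e (block ++ β) → Avoids (residual e a) β
  Avoids-block⁻ e av@(_ , _ , ¬cω) =
    let (¬c₁ , ¬c₂ , _) = Avoids-⊆ {e} (++⁺ˡ block ⊆-refl) av in ¬c₁ , ¬c₂ , ¬cω ∘ ω′-occurrence
    where
    b = budget e a
    ω′≡ : decRun (3 + residual e a) b ++ ω′ (residual e a) ≡ ω′ e
    ω′≡ = trans (sym (ω′-+ b (residual e a))) (cong ω′ (budget+residual e a))
    ω′-occurrence : Contains β (ω′ (residual e a)) → Contains (block ++ β) (ω′ e)
    ω′-occurrence c = subst (Contains (block ++ β)) ω′≡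
      (join-Above block>β (decRun-above-ω′ (residual e a) b) (decRun-in-block j a n _ b run<n (m⊓n≤n e (1 ⊔ a))) c)

  length-block : length block ≡ suc a
  length-block = trans (length-++ (decRun j a)) (trans (cong (_+ 1) (length-decRun j a)) (+-comm a 1))

  block-DecThenMax : ∀ {σ} → Contains block σ → DecThenMax σ
  block-DecThenMax = Contains-DecThenMax (decRun-Decreasing j a) run<n

  block-132⁻ : Contains (block ++ β) p132 → Contains β p132
  block-132⁻ c with split-Above {block} {β} {p132} block>β c
  ... | [] , _ , refl , _ , _ , c₂ = c₂
  ... | _ ∷ [] , _ , refl , () , _
  ... | _ ∷ _ ∷ [] , _ , refl , () , _
  ... | _ ∷ _ ∷ _ ∷ [] , _ , refl , _ , c₁ , _ = ⊥-elim (¬132 (block-DecThenMax c₁))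
    where
    ¬132 : ¬ DecThenMax p132
    ¬132 = ¬DecThenMax (1 ∷ 3 ∷ []) 2 (λ { ((s≤s () ∷ _) ∷ _) }) (λ { ((s≤s () ∷ []) ∷ _) _ })

  block-2341⁻ : Contains (block ++ β) p2341 → Contains β p2341
  block-2341⁻ c with split-Above {block} {β} {p2341} block>β c
  ... | [] , _ , refl , _ , _ , c₂ = c₂
  ... | _ ∷ [] , _ , refl , () , _
  ... | _ ∷ _ ∷ [] , _ , refl , () , _
  ... | _ ∷ _ ∷ _ ∷ [] , _ , refl , _ , c₁ , _ = ⊥-elim (¬234 (block-DecThenMax c₁))
    where
    ¬234 : ¬ DecThenMax (2 ∷ 3 ∷ 4 ∷ [])
    ¬234 = ¬DecThenMax (2 ∷ 3 ∷ []) 4 (λ { ((s≤s (s≤s ()) ∷ _) ∷ _) }) (λ { ((s≤s (s≤s ()) ∷ []) ∷ _) _ })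
  ... | _ ∷ _ ∷ _ ∷ _ ∷ [] , _ , refl , _ , c₁ , _ = ⊥-elim (¬2341 (block-DecThenMax c₁))
    where
    ¬2341 : ¬ DecThenMax p2341
    ¬2341 = ¬DecThenMax (2 ∷ 3 ∷ 4 ∷ []) 1 (λ { ((s≤s (s≤s ()) ∷ _) ∷ _) }) (λ { ((s≤s (s≤s ()) ∷ _) ∷ _) _ })

  block-ω′⁻ : ∀ e → (e ≡ 0 → a ≤ 1) → Contains (block ++ β) (ω′ e) → Contains β (ω′ (residual e a))
  block-ω′⁻ e a≤1 c with split-Above {block} {β} {ω′ e} block>β c
  ... | σ₁ , σ₂ , eq , σ₁>σ₂ , c₁ , c₂ with ++≡++⁻ σ₁ σ₂ (decRun 3 e) (2 ∷ 1 ∷ 3 ∷ []) (sym eq)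
  ... | inj₁ (w , run≡ , refl) with decRun≡++ 3 e σ₁ w run≡
  ...   | t , r , refl , refl , refl = Contains-ω′-mono (r ∸ residual t+r a) (residual t+r a)
            (subst (Contains β) (cong ω′ (sym (m∸n+n≡m residual≤r))) c₂)
    where
    t+r = t + r
    t≤budget : t ≤ budget t+r a
    t≤budget = ⊓-glb (m≤m+n t r) (decRun-in-block⇒≤ j a n (3 + r) t run<n c₁)
    residual≤r : residual t+r a ≤ r
    residual≤r = ≤-trans (∸-monoʳ-≤ t+r t≤budget) (≤-reflexive (m+n∸m≡n t r))
  block-ω′⁻ e a≤1 c | σ₁ , σ₂ , eq , σ₁>σ₂ , c₁ , c₂ | inj₂ (z , w , refl , tail≡) =
    ⊥-elim (in-213 e a≤1 z w σ₂ tail≡ (above?-++⁻ʳ (decRun 3 e) (z ∷ w) σ₂ σ₁>σ₂) c₁)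
    where
    in-213 : ∀ e → (e ≡ 0 → a ≤ 1) → ∀ z w σ₂ → 2 ∷ 1 ∷ 3 ∷ [] ≡ z ∷ w ++ σ₂ →
             T (above? (z ∷ w) σ₂) → Contains block (decRun 3 e ++ z ∷ w) → ⊥
    in-213 e _ z [] σ₂ refl () _
    in-213 e _ z (_ ∷ []) σ₂ refl () _
    in-213 (suc e) _ z (_ ∷ _ ∷ []) σ₂ refl _ c₁ = ¬ω′ (block-DecThenMax (subst (Contains block) ω′-snoc c₁))
      where
      ω′-snoc : ω′ (suc e) ≡ (decRun 3 (suc e) ++ 2 ∷ 1 ∷ []) ++ [ 3 ]
      ω′-snoc = sym (++-assoc (decRun 3 (suc e)) (2 ∷ 1 ∷ []) [ 3 ])
      ¬ω′ : ¬ DecThenMax ((decRun 3 (suc e) ++ 2 ∷ 1 ∷ []) ++ [ 3 ])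
      ¬ω′ = ¬DecThenMax (decRun 3 (suc e) ++ 2 ∷ 1 ∷ []) 3
              (λ d → case AllPairs-resp-⊆ (++⁺ (++⁺ˡ (decRun 3 (suc e)) ⊆-refl) ⊆-refl) d of
                       λ { ((_ ∷ s≤s (s≤s ()) ∷ []) ∷ _) })
              (λ _ → λ { (s≤s (s≤s (s≤s ())) ∷ _) })
    in-213 zero a≤1 z (_ ∷ _ ∷ []) σ₂ refl _ c₁ =
      case ≤-trans (Contains-length c₁) (≤-trans (≤-reflexive length-block) (s≤s (a≤1 refl))) of
        λ { (s≤s (s≤s ())) }

  Avoids-block⁺ : ∀ e → (e ≡ 0 → a ≤ 1) → Avoids (residual e a) β → Avoids e (block ++ β)
  Avoids-block⁺ e a≤1 (¬c₁ , ¬c₂ , ¬c₃) = ¬c₁ ∘ block-132⁻ , ¬c₂ ∘ block-2341⁻ , ¬c₃ ∘ block-ω′⁻ e a≤1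

IsPerm-exhaustive : ∀ {n π v} → IsPerm n π → InRange 0 n v → v ∈ π
IsPerm-exhaustive {n} {π} (u , r , e) =
  Unique-⊆ˢ⇒⊇ˢ π (incRun 0 n) u (∈-incRun⁺ 0 n ∘ All.lookup r) (≤-reflexive (trans (length-incRun 0 n) (sym e)))
  ∘ ∈-incRun⁺ 0 n

split-at-max : ∀ m π → IsPerm (suc m) π → ∃₂ λ α β → π ≡ α ++ suc m ∷ β
split-at-max m π perm with ∈-∃++ (IsPerm-exhaustive perm (s≤s z≤n , ≤-refl))
... | α , β , eq = α , β , eq

record UniqueAround (α : List ℕ) (n : ℕ) (β : List ℕ) : Set where
  field
    uα : Unique α
    uβ : Unique β
    n∉α : ¬ n ∈ α
    n∉β : ¬ n ∈ β
    α#β : ∀ {a b} → a ∈ α → b ∈ β → a ≢ b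

uniqueAround : ∀ α n β → Unique (α ++ n ∷ β) → UniqueAround α n β
uniqueAround [] n β (n∉β ∷ u) = record
  { uα = [] ; uβ = u ; n∉α = λ () ; n∉β = λ p → All.lookup n∉β p refl ; α#β = λ () }
uniqueAround (x ∷ α) n β (x∉ ∷ u) = record
  { uα = All.tabulate (All.lookup x∉ ∘ ∈-++⁺ˡ) ∷ U.uα
  ; uβ = U.uβ
  ; n∉α = λ { (here refl) → All.lookup x∉ (∈-++⁺ʳ α (here refl)) refl ; (there p) → U.n∉α p }
  ; n∉β = U.n∉β
  ; α#β = λ { (here refl) q → All.lookup x∉ (∈-++⁺ʳ α (there q)) ; (there p) q → U.α#β p q } }
  where module U = UniqueAround (uniqueAround α n β u)

module AroundMax (m : ℕ) (α β : List ℕ) (perm : IsPerm (suc m) (α ++ suc m ∷ β)) where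

  n = suc m
  π = α ++ n ∷ β
  open UniqueAround (uniqueAround α n β (proj₁ perm)) public

  below-n : ∀ {v} → v ∈ π → v ≢ n → InRange 0 m v
  below-n v∈π v≢n with All.lookup (proj₁ (proj₂ perm)) v∈π
  ... | 0<v , v≤n = 0<v , ≤-pred (≤∧≢⇒< v≤n v≢n)

  α-range : All (InRange 0 m) α
  α-range = All.tabulate (λ v∈α → below-n (∈-++⁺ˡ v∈α) (λ { refl → n∉α v∈α }))

  β-range : All (InRange 0 m) β
  β-range = All.tabulate (λ v∈β → below-n (∈-++⁺ʳ α (there v∈β)) (λ { refl → n∉β v∈β }))

  α<n : All (_< n) α
  α<n = All.map (s≤s ∘ proj₂) α-range

  β<n : All (_< n) β
  β<n = All.map (s≤s ∘ proj₂) β-range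

  length-αβ : length α + length β ≡ m
  length-αβ = suc-injective (trans (sym (+-suc (length α) (length β))) (trans (sym (length-++ α)) (proj₂ (proj₂ perm))))

  -- An entry of α below an entry b of β would form 132 with n.
  α-above-β : ¬ Contains π p132 → Above α β
  α-above-β ¬c = All.tabulate λ {a} a∈α → All.tabulate λ {b} b∈β → compare a∈α b∈β
    where
    compare : ∀ {a b} → a ∈ α → b ∈ β → b < a
    compare {a} {b} a∈α b∈β with <-cmp a b
    ... | tri< a<b _ _ = ⊥-elim (¬c (occ (++⁺ (from∈ a∈α) (refl ∷ from∈ b∈β))
                                        (132-occurrence a<b (All.lookup β<n b∈β) (All.lookup α<n a∈α))))
    ... | tri≈ _ a≡b _ = ⊥-elim (α#β a∈α b∈β a≡b)
    ... | tri> _ _ b<a = b<a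

  -- An ascent of α would form 2341 with n and any entry of β.
  α-decreasing : ¬ Contains π p2341 → Above α β → ∀ b β′ → β ≡ b ∷ β′ → Decreasing α
  α-decreasing ¬c α>β b β′ refl = noAscent⇒Decreasing α uα λ x y xy⊆α x<y →
    ¬c (occ (++⁺ xy⊆α (refl ∷ refl ∷ []⊆-universal β′))
            (2341-occurrence (All.lookup (All.lookup α>β (to∈ xy⊆α)) (here refl)) x<y
                             (All.lookup α<n (to∈ (∷ˡ⁻ xy⊆α)))))

  α-perm : β ≡ [] → IsPerm m α
  α-perm refl = uα , α-range , trans (sym (+-identityʳ (length α))) length-αβ

  j = length β
  a = length α

  module _ (α>β : Above α β) where

    β-perm : IsPerm j β
    β-perm = uβ , All.tabulate (λ b∈β → proj₁ (All.lookup β-range b∈β) , b≤j b∈β) , refl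
      where
      b≤j : ∀ {b} → b ∈ β → b ≤ j
      b≤j {b} b∈β = subst (_≤ j) (length-incRun 0 b)
        (Unique-⊆ˢ⇒length≤ (incRun 0 b) β (Increasing⇒Unique (incRun-Increasing 0 b)) (in-β ∘ ∈-incRun⁻ 0 b))
        where
        b≤m = proj₂ (All.lookup β-range b∈β)
        in-β : ∀ {v} → InRange 0 b v → v ∈ β
        in-β {v} (0<v , v≤b) with ∈-++⁻ α (IsPerm-exhaustive perm (0<v , ≤-trans v≤b (≤-trans b≤m (n≤1+n m))))
        ... | inj₁ v∈α = ⊥-elim (<⇒≱ (All.lookup (All.lookup α>β v∈α) b∈β) v≤b)
        ... | inj₂ (here refl) = ⊥-elim (<⇒≱ (s≤s b≤m) v≤b)
        ... | inj₂ (there v∈β) = v∈β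

    α-range′ : All (InRange j a) α
    α-range′ = All.tabulate λ {v} v∈α →
      j<v v∈α , subst (v ≤_) (sym (trans (+-comm j a) length-αβ)) (proj₂ (All.lookup α-range v∈α))
      where
      j<v : ∀ {v} → v ∈ α → j < v
      j<v {v} v∈α with 0 <? j
      ... | no j≯0 = subst (_< v) (sym (n≤0⇒n≡0 (≮⇒≥ j≯0))) (proj₁ (All.lookup α-range v∈α))
      ... | yes 0<j = All.lookup (All.lookup α>β v∈α) (IsPerm-exhaustive β-perm (0<j , ≤-refl))

    α≡decRun : Decreasing α → α ≡ decRun j a
    α≡decRun d = decRun-unique j a α d refl α-range′

IsPerm-++-max : ∀ m α → IsPerm m α → IsPerm (suc m) (α ++ [ suc m ])
IsPerm-++-max m α (u , r , e) =
  Uniqueₚ.++⁺ u ([] ∷ []) (λ { (p , here refl) → 1+n≰n (proj₂ (All.lookup r p)) }) ,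
  Allₚ.++⁺ (All.map (λ (0<v , v≤m) → 0<v , ≤-trans v≤m (n≤1+n m)) r) ((s≤s z≤n , ≤-refl) ∷ []) ,
  trans (length-++ α) (trans (+-comm (length α) 1) (cong suc e))

IsPerm⇒All< : ∀ m α → IsPerm m α → All (_< suc m) α
IsPerm⇒All< m α (_ , r , _) = All.map (s≤s ∘ proj₂) r

decRun<max : ∀ j a m → j + a ≡ m → All (_< suc m) (decRun j a)
decRun<max j a m j+a≡m = All.tabulate λ v∈ → s≤s (≤-trans (proj₂ (∈-decRun⁻ j a v∈)) (≤-reflexive j+a≡m))

block-Above : ∀ j a m β → j + a ≡ m → IsPerm j β → Above (decRun j a ++ [ suc m ]) β
block-Above j a m β j+a≡m (_ , r , _) = Allₚ.++⁺
  (All.tabulate λ v∈ → All.map (λ (_ , w≤j) → ≤-<-trans w≤j (proj₁ (∈-decRun⁻ j a v∈))) r)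
  (All.map (λ (_ , w≤j) → s≤s (≤-trans w≤j (subst (j ≤_) j+a≡m (m≤m+n j a)))) r ∷ [])

IsPerm-block : ∀ j a m β → j + a ≡ m → IsPerm j β → IsPerm (suc m) (decRun j a ++ suc m ∷ β)
IsPerm-block j a m β j+a≡m (u , r , e) =
  Uniqueₚ.++⁺ (Decreasing⇒Unique (decRun-Decreasing j a))
              (All.map (λ (_ , w≤j) w≡n → 1+n≰n (subst (_≤ m) (sym w≡n) (≤-trans w≤j j≤m))) r ∷ u) disjoint ,
  Allₚ.++⁺ (All.tabulate λ v∈ → let (j<v , v≤j+a) = ∈-decRun⁻ j a v∈
                                 in ≤-trans (s≤s z≤n) j<v , ≤-trans v≤j+a (≤-trans (≤-reflexive j+a≡m) (n≤1+n m)))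
           ((s≤s z≤n , ≤-refl) ∷ All.map (λ (0<w , w≤j) → 0<w , ≤-trans w≤j (≤-trans j≤m (n≤1+n m))) r) ,
  trans (length-++ (decRun j a))
        (trans (cong₂ _+_ (length-decRun j a) (cong suc e)) (trans (+-suc a j) (cong suc (trans (+-comm a j) j+a≡m))))
  where
  j≤m : j ≤ m
  j≤m = subst (j ≤_) j+a≡m (m≤m+n j a)
  disjoint : ∀ {v} → ¬ (v ∈ decRun j a × v ∈ suc m ∷ β)
  disjoint (v∈ , here refl) = 1+n≰n (subst (suc m ≤_) j+a≡m (proj₂ (∈-decRun⁻ j a v∈)))
  disjoint (v∈ , there v∈β) = <⇒≱ (proj₁ (∈-decRun⁻ j a v∈)) (proj₂ (All.lookup r v∈β))

IsPerm-incRun : ∀ m → IsPerm m (incRun 0 m)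
IsPerm-incRun m = Increasing⇒Unique (incRun-Increasing 0 m) , All.tabulate (∈-incRun⁻ 0 m) , length-incRun 0 m

-- The recursion for count

endMax : ℕ → ℕ → List (List ℕ)
endMax zero m = [ incRun 0 m ++ [ suc m ] ]
endMax (suc e) m = map (_++ [ suc m ]) (avoiders (4 + e) m)

runLengths : ℕ → ℕ → List ℕ
runLengths zero m = upTo (2 ⊓ m)
runLengths (suc e) m = upTo m

innerMax : ℕ → ℕ → ℕ → List (List ℕ)
innerMax e m a = map (λ β → decRun (m ∸ a) a ++ suc m ∷ β) (avoiders (3 + residual e a) (m ∸ a))

decomposition : ℕ → ℕ → List (List ℕ)
decomposition e m = endMax e m ++ concatMap (innerMax e m) (runLengths e m)

∈-runLengths⁻ : ∀ e m {a} → a ∈ runLengths e m → a < m × (e ≡ 0 → a ≤ 1)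
∈-runLengths⁻ zero m a∈ = ≤-trans (∈-upTo⁻ a∈) (m⊓n≤n 2 m) , λ _ → ≤-pred (≤-trans (∈-upTo⁻ a∈) (m⊓n≤m 2 m))
∈-runLengths⁻ (suc e) m a∈ = ∈-upTo⁻ a∈ , λ ()

∈-runLengths⁺ : ∀ e m {a} → a < m → (e ≡ 0 → a ≤ 1) → a ∈ runLengths e m
∈-runLengths⁺ zero m a<m a≤1 = ∈-upTo⁺ (⊓-glb (s≤s (a≤1 refl)) a<m)
∈-runLengths⁺ (suc e) m a<m _ = ∈-upTo⁺ a<m

decomposition⊆avoiders : ∀ e m → decomposition e m ⊆ˢ avoiders (3 + e) (suc m)
decomposition⊆avoiders e m {π} π∈ with ∈-++⁻ (endMax e m) π∈
decomposition⊆avoiders zero m _ | inj₁ (here refl) =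
  from (∈-avoiders⇔ 0 (suc m) _)
    (IsPerm-++-max m _ (IsPerm-incRun m) ,
     Increasing⇒Avoids₀-++-max (incRun 0 m) (suc m) (incRun-Increasing 0 m) (IsPerm⇒All< m _ (IsPerm-incRun m)))
decomposition⊆avoiders (suc e) m _ | inj₁ π∈ with ∈-map⁻ _ π∈
... | α , α∈ , refl =
  let (perm , av) = to (∈-avoiders⇔ (suc e) m α) α∈
  in from (∈-avoiders⇔ (suc e) (suc m) _) (IsPerm-++-max m α perm , Avoids-++-max⁺ e α (suc m) (IsPerm⇒All< m α perm) av)
decomposition⊆avoiders e m _ | inj₂ π∈ with find (∈-concatMap⁻ (innerMax e m) {xs = runLengths e m} π∈)
... | a , a∈ , π∈′ with ∈-map⁻ _ π∈′ | ∈-runLengths⁻ e m a∈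
... | β , β∈ , refl | a<m , a≤1 =
  let (perm , av) = to (∈-avoiders⇔ (residual e a) (m ∸ a) β) β∈
      open Block (m ∸ a) a (suc m) β (decRun<max (m ∸ a) a m j+a≡m) (block-Above (m ∸ a) a m β j+a≡m perm)
  in from (∈-avoiders⇔ e (suc m) _)
       (IsPerm-block (m ∸ a) a m β j+a≡m perm ,
        subst (Avoids e) (++-assoc (decRun (m ∸ a) a) [ suc m ] β) (Avoids-block⁺ e a≤1 av))
  where
  j+a≡m : m ∸ a + a ≡ m
  j+a≡m = m∸n+n≡m (<⇒≤ a<m)

endMax-complete : ∀ e m α → IsPerm m α → Avoids e (α ++ [ suc m ]) → α ++ [ suc m ] ∈ decomposition e m
endMax-complete zero m α perm@(u , r , len) av = ∈-++⁺ˡ {ys = concatMap (innerMax 0 m) (runLengths 0 m)} (here (cong (_++ [ suc m ])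
  (incRun-unique 0 m α (Avoids₀-++-max⇒Increasing α (suc m) u (IsPerm⇒All< m α perm) av) len r)))
endMax-complete (suc e) m α perm av =
  ∈-++⁺ˡ (∈-map⁺ (_++ [ suc m ]) (from (∈-avoiders⇔ (suc e) m α) (perm , Avoids-⊆ {suc e} (++⁺ʳ [ suc m ] ⊆-refl) av)))

innerMax-complete : ∀ e m a β → a < m → IsPerm (m ∸ a) β → Avoids e (decRun (m ∸ a) a ++ suc m ∷ β) →
                    decRun (m ∸ a) a ++ suc m ∷ β ∈ decomposition e m
innerMax-complete e m a β a<m perm av =
  ∈-++⁺ʳ (endMax e m) (∈-concatMap⁺ (innerMax e m) {xs = runLengths e m}
    (lose (∈-runLengths⁺ e m a<m (λ { refl → Avoids₀-block⇒≤1 j a (suc m) β run<n av′ }))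
          (∈-map⁺ (λ β → decRun j a ++ suc m ∷ β) (from (∈-avoiders⇔ (residual e a) j β) (perm , Avoids-block⁻ e av′)))))
  where
  j = m ∸ a
  j+a≡m : j + a ≡ m
  j+a≡m = m∸n+n≡m (<⇒≤ a<m)
  run<n = decRun<max j a m j+a≡m
  open Block j a (suc m) β run<n (block-Above j a m β j+a≡m perm)
  av′ : Avoids e (block ++ β)
  av′ = subst (Avoids e) (sym (++-assoc (decRun j a) [ suc m ] β)) av

avoiders⊆decomposition : ∀ e m → avoiders (3 + e) (suc m) ⊆ˢ decomposition e m
avoiders⊆decomposition e m {π} π∈ with to (∈-avoiders⇔ e (suc m) π) π∈
... | perm , av with split-at-max m π perm
... | α , β , refl = by-β β refl
  where
  open AroundMax m α β perm
  by-β : ∀ β′ → β ≡ β′ → α ++ suc m ∷ β ∈ decomposition e m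
  by-β [] refl = endMax-complete e m α (α-perm refl) av
  by-β (b ∷ β′) refl =
    subst (λ α → α ++ suc m ∷ β ∈ decomposition e m) (sym α≡run)
      (innerMax-complete e m a β a<m (subst (λ j → IsPerm j β) j≡m∸a (β-perm α>β))
        (subst (λ α → Avoids e (α ++ suc m ∷ β)) α≡run av))
    where
    α>β = α-above-β (proj₁ av)
    j+a≡m : j + a ≡ m
    j+a≡m = trans (+-comm j a) length-αβ
    j≡m∸a : j ≡ m ∸ a
    j≡m∸a = sym (trans (cong (_∸ a) (sym j+a≡m)) (m+n∸n≡m j a))
    a<m : a < m
    a<m = subst (suc a ≤_) j+a≡m (+-monoˡ-≤ a (s≤s z≤n))
    α≡run : α ≡ decRun (m ∸ a) a
    α≡run = trans (α≡decRun α>β (α-decreasing (proj₁ (proj₂ av)) α>β b β′ refl)) (cong (λ j → decRun j a) j≡m∸a)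

++-∷-cancel : ∀ (xs xs′ : List ℕ) n ys ys′ → xs ++ n ∷ ys ≡ xs′ ++ n ∷ ys′ → ¬ n ∈ xs → ¬ n ∈ xs′ →
              xs ≡ xs′ × ys ≡ ys′
++-∷-cancel [] [] n ys ys′ eq _ _ = refl , ∷-injectiveʳ eq
++-∷-cancel [] (x ∷ xs′) n ys ys′ eq _ n∉xs′ = ⊥-elim (n∉xs′ (here (∷-injectiveˡ eq)))
++-∷-cancel (x ∷ xs) [] n ys ys′ eq n∉xs _ = ⊥-elim (n∉xs (here (sym (∷-injectiveˡ eq))))
++-∷-cancel (x ∷ xs) (x′ ∷ xs′) n ys ys′ eq n∉xs n∉xs′ with ∷-injective eq
... | refl , eq′ with ++-∷-cancel xs xs′ n ys ys′ eq′ (n∉xs ∘ there) (n∉xs′ ∘ there)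
... | refl , refl = refl , refl

max∉decRun : ∀ j a m → j + a ≡ m → ¬ suc m ∈ decRun j a
max∉decRun j a m j+a≡m n∈ = 1+n≰n (subst (suc m ≤_) j+a≡m (proj₂ (∈-decRun⁻ j a n∈)))

innerMax-form : ∀ e m {a π} → a ∈ runLengths e m → π ∈ innerMax e m a →
                ∃ λ β → π ≡ decRun (m ∸ a) a ++ suc m ∷ β × 0 < length β × m ∸ a + a ≡ m
innerMax-form e m {a} a∈ π∈ with ∈-map⁻ _ π∈
... | β , β∈ , refl =
  let ((_ , _ , len) , _) = to (∈-avoiders⇔ (residual e a) (m ∸ a) β) β∈
      a<m = proj₁ (∈-runLengths⁻ e m a∈)
  in β , refl , subst (0 <_) (sym len) (n≢0⇒n>0 (m>n⇒m∸n≢0 a<m)) , m∸n+n≡m (<⇒≤ a<m)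

endMax-form : ∀ e m {π} → π ∈ endMax e m → ∃ λ α → π ≡ α ++ [ suc m ] × ¬ suc m ∈ α
endMax-form zero m (here refl) = incRun 0 m , refl , λ n∈ → 1+n≰n (proj₂ (∈-incRun⁻ 0 m n∈))
endMax-form (suc e) m π∈ with ∈-map⁻ _ π∈
... | α , α∈ , refl =
  let ((_ , r , _) , _) = to (∈-avoiders⇔ (suc e) m α) α∈ in α , refl , λ n∈ → 1+n≰n (proj₂ (All.lookup r n∈))

decomposition-Unique : ∀ e m → Unique (decomposition e m)
decomposition-Unique e m = Uniqueₚ.++⁺ (endMax-Unique e) inner-Unique end#inner
  where
  endMax-Unique : ∀ e → Unique (endMax e m)
  endMax-Unique zero = [] ∷ []
  endMax-Unique (suc e) = Uniqueₚ.map⁺ (λ {x} {y} eq → proj₁ (∷ʳ-injective x y eq)) (avoiders-Unique (4 + e) m)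
  runLengths-Unique : ∀ e → Unique (runLengths e m)
  runLengths-Unique zero = Uniqueₚ.upTo⁺ _
  runLengths-Unique (suc e) = Uniqueₚ.upTo⁺ _
  sameLength : ∀ {a a′ π} → a ∈ runLengths e m → a′ ∈ runLengths e m →
               π ∈ innerMax e m a → π ∈ innerMax e m a′ → a ≡ a′
  sameLength {a} {a′} a∈ a′∈ π∈ π∈′ with innerMax-form e m a∈ π∈ | innerMax-form e m a′∈ π∈′
  ... | β , refl , _ , j+a≡m | β′ , eq , _ , j+a′≡m
    with ++-∷-cancel _ _ (suc m) β β′ eq (max∉decRun _ a m j+a≡m) (max∉decRun _ a′ m j+a′≡m)
  ... | run≡ , _ = trans (sym (length-decRun (m ∸ a) a)) (trans (cong length run≡) (length-decRun (m ∸ a′) a′))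
  inner-Unique : Unique (concatMap (innerMax e m) (runLengths e m))
  inner-Unique = Unique-concatMap⁺ (innerMax e m) (runLengths e m) (runLengths-Unique e)
    (λ {a} _ → Uniqueₚ.map⁺ (λ {x} {y} eq → ∷-injectiveʳ (++-cancelˡ (decRun (m ∸ a) a) (suc m ∷ x) (suc m ∷ y) eq))
                            (avoiders-Unique (3 + residual e a) (m ∸ a)))
    sameLength
  end#inner : ∀ {π} → ¬ (π ∈ endMax e m × π ∈ concatMap (innerMax e m) (runLengths e m))
  end#inner (π∈ , π∈′) with endMax-form e m π∈ | find (∈-concatMap⁻ (innerMax e m) {xs = runLengths e m} π∈′)
  ... | α , refl , n∉α | a , a∈ , π∈″ with innerMax-form e m a∈ π∈″
  ... | β , eq , 0<|β| , j+a≡m with ++-∷-cancel α _ (suc m) [] β eq n∉α (max∉decRun _ a m j+a≡m)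
  ... | _ , refl with 0<|β|
  ... | ()

count≡length-decomposition : ∀ e m → count (3 + e) (suc m) ≡ length (decomposition e m)
count≡length-decomposition e m = Unique-⊆ˢ⇒length≡ (avoiders (3 + e) (suc m)) (decomposition e m)
  (avoiders-Unique (3 + e) (suc m)) (decomposition-Unique e m) (avoiders⊆decomposition e m) (decomposition⊆avoiders e m)

length-concatMap : ∀ {A B : Set} (f : A → List B) xs → length (concatMap f xs) ≡ sum (map (length ∘ f) xs)
length-concatMap f [] = refl
length-concatMap f (x ∷ xs) = trans (length-++ (f x)) (cong (length (f x) +_) (length-concatMap f xs))

count-recursion : ∀ e m → count (3 + e) (suc m) ≡
                  length (endMax e m) + sum (map (λ a → count (3 + residual e a) (m ∸ a)) (runLengths e m))
count-recursion e m = trans (count≡length-decomposition e m) (trans (length-++ (endMax e m))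
  (cong (length (endMax e m) +_) (trans (length-concatMap (innerMax e m) (runLengths e m))
    (cong sum (map-cong (λ a → length-map _ (avoiders (3 + residual e a) (m ∸ a))) (runLengths e m))))))

-- Coefficientwise series algebra

sumBelow : ℕ → (ℕ → ℤ) → ℤ
sumBelow N f = foldr _+ℤ_ 0ℤ (applyUpTo f N)

⊛-sumBelow : ∀ f h n → (f ⊛ h) n ≡ sumBelow (suc n) (λ i → f i *ℤ h (n ∸ i))
⊛-sumBelow f h n = cong (foldr _+ℤ_ 0ℤ) (map-applyUpTo (λ i → i) (λ i → f i *ℤ h (n ∸ i)) (suc n))

sumBelow-cong : ∀ {f g} N → (∀ i → f i ≡ g i) → sumBelow N f ≡ sumBelow N g
sumBelow-cong zero _ = refl
sumBelow-cong (suc N) f≗g = cong₂ _+ℤ_ (f≗g 0) (sumBelow-cong N (f≗g ∘ suc))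

sumBelow-+ : ∀ f g N → sumBelow N (λ i → f i +ℤ g i) ≡ sumBelow N f +ℤ sumBelow N g
sumBelow-+ f g zero = refl
sumBelow-+ f g (suc N) = trans (cong (f 0 +ℤ g 0 +ℤ_) (sumBelow-+ (f ∘ suc) (g ∘ suc) N))
  (interchange (f 0) (g 0) (sumBelow N (f ∘ suc)) (sumBelow N (g ∘ suc)))
  where
  interchange : ∀ a b c d → (a +ℤ b) +ℤ (c +ℤ d) ≡ (a +ℤ c) +ℤ (b +ℤ d)
  interchange = solve-∀

sumBelow-- : ∀ f g N → sumBelow N (λ i → f i -ℤ g i) ≡ sumBelow N f -ℤ sumBelow N g
sumBelow-- f g zero = refl
sumBelow-- f g (suc N) = trans (cong (f 0 -ℤ g 0 +ℤ_) (sumBelow-- (f ∘ suc) (g ∘ suc) N))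
  (interchange (f 0) (g 0) (sumBelow N (f ∘ suc)) (sumBelow N (g ∘ suc)))
  where
  interchange : ∀ a b c d → (a -ℤ b) +ℤ (c -ℤ d) ≡ (a +ℤ c) -ℤ (b +ℤ d)
  interchange = solve-∀

sumBelow-zero : ∀ {f} N → (∀ i → f i ≡ 0ℤ) → sumBelow N f ≡ 0ℤ
sumBelow-zero zero _ = refl
sumBelow-zero (suc N) f≗0 = trans (cong₂ _+ℤ_ (f≗0 0) (sumBelow-zero N (f≗0 ∘ suc))) refl

+sum≡sumBelow : ∀ (f : ℕ → ℕ) N → ℤ.+ sum (map f (upTo N)) ≡ sumBelow N (ℤ.+_ ∘ f)
+sum≡sumBelow f N = trans (cong (ℤ.+_ ∘ sum) (map-applyUpTo (λ i → i) f N)) (go f N)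
  where
  go : ∀ (f : ℕ → ℕ) N → ℤ.+ sum (applyUpTo f N) ≡ sumBelow N (ℤ.+_ ∘ f)
  go f zero = refl
  go f (suc N) = cong (ℤ.+ f 0 +ℤ_) (go (f ∘ suc) N)

sumS≡sumBelow : ∀ (F : ℕ → Series) N n → sumS (map F (upTo N)) n ≡ sumBelow N (λ i → F i n)
sumS≡sumBelow F N n = trans (cong (λ l → sumS l n) (map-applyUpTo (λ i → i) F N)) (go F N)
  where
  go : ∀ (F : ℕ → Series) N → sumS (applyUpTo F N) n ≡ sumBelow N (λ i → F i n)
  go F zero = refl
  go F (suc N) = cong (F 0 n +ℤ_) (go (F ∘ suc) N)

⊛-congˡ : ∀ {f f′} h n → f ≈ f′ → (f ⊛ h) n ≡ (f′ ⊛ h) n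
⊛-congˡ {f} {f′} h n f≈f′ = trans (⊛-sumBelow f h n)
  (trans (sumBelow-cong (suc n) (λ i → cong (_*ℤ h (n ∸ i)) (f≈f′ i))) (sym (⊛-sumBelow f′ h n)))

⊛-distribʳ-⊕ : ∀ f f′ h n → ((f ⊕ f′) ⊛ h) n ≡ (f ⊛ h) n +ℤ (f′ ⊛ h) n
⊛-distribʳ-⊕ f f′ h n = trans (⊛-sumBelow (f ⊕ f′) h n)
  (trans (sumBelow-cong (suc n) (λ i → *-distribʳ-+ (h (n ∸ i)) (f i) (f′ i)))
  (trans (sumBelow-+ (λ i → f i *ℤ h (n ∸ i)) (λ i → f′ i *ℤ h (n ∸ i)) (suc n))
         (sym (cong₂ _+ℤ_ (⊛-sumBelow f h n) (⊛-sumBelow f′ h n)))))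

⊛-distribʳ-⊖ : ∀ f f′ h n → ((f ⊖ f′) ⊛ h) n ≡ (f ⊛ h) n -ℤ (f′ ⊛ h) n
⊛-distribʳ-⊖ f f′ h n = trans (⊛-sumBelow (f ⊖ f′) h n)
  (trans (sumBelow-cong (suc n) (λ i → *-distribʳ-- (f i) (f′ i) (h (n ∸ i))))
  (trans (sumBelow-- (λ i → f i *ℤ h (n ∸ i)) (λ i → f′ i *ℤ h (n ∸ i)) (suc n))
         (sym (cong₂ _-ℤ_ (⊛-sumBelow f h n) (⊛-sumBelow f′ h n)))))
  where
  *-distribʳ-- : ∀ a b c → (a -ℤ b) *ℤ c ≡ a *ℤ c -ℤ b *ℤ c
  *-distribʳ-- = solve-∀

shift : ℕ → Series → Series
shift zero h n = h n
shift (suc r) h zero = 0ℤ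
shift (suc r) h (suc n) = shift r h n

X^-⊛ : ∀ r h n → (X^ r ⊛ h) n ≡ shift r h n
X^-⊛ zero h n = trans (⊛-sumBelow (X^ 0) h n)
  (trans (cong₂ _+ℤ_ (*-identityˡ (h n)) (sumBelow-zero n (λ i → *-zeroˡ (h (n ∸ suc i))))) (+ℤ-identityʳ (h n)))
X^-⊛ (suc r) h zero = cong (_+ℤ 0ℤ) (*-zeroˡ (h 0))
X^-⊛ (suc r) h (suc n) = trans (⊛-sumBelow (X^ (suc r)) h (suc n))
  (trans (cong (_+ℤ sumBelow (suc n) (λ i → X^ (suc r) (suc i) *ℤ h (suc n ∸ suc i))) (*-zeroˡ (h (suc n))))
  (trans (+-identityˡ _) (trans (sym (⊛-sumBelow (X^ r) h n)) (X^-⊛ r h n))))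

shift-⊕ : ∀ r f f′ n → shift r (f ⊕ f′) n ≡ shift r f n +ℤ shift r f′ n
shift-⊕ zero f f′ n = refl
shift-⊕ (suc r) f f′ zero = refl
shift-⊕ (suc r) f f′ (suc n) = shift-⊕ r f f′ n

shift-⊖ : ∀ r f f′ n → shift r (f ⊖ f′) n ≡ shift r f n -ℤ shift r f′ n
shift-⊖ zero f f′ n = refl
shift-⊖ (suc r) f f′ zero = refl
shift-⊖ (suc r) f f′ (suc n) = shift-⊖ r f f′ n

shift-cong : ∀ r {f f′} n → f ≈ f′ → shift r f n ≡ shift r f′ n
shift-cong zero n f≈f′ = f≈f′ n
shift-cong (suc r) zero _ = refl
shift-cong (suc r) (suc n) f≈f′ = shift-cong r n f≈f′

shift-comm : ∀ r f n → shift 1 (shift r f) n ≡ shift r (shift 1 f) n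
shift-comm zero f n = refl
shift-comm (suc r) f zero = refl
shift-comm (suc r) f (suc zero) = sym (shift-at-0 r)
  where
  shift-at-0 : ∀ r → shift r (shift 1 f) 0 ≡ 0ℤ
  shift-at-0 zero = refl
  shift-at-0 (suc r) = refl
shift-comm (suc r) f (suc (suc n)) = shift-comm r f (suc n)

Δ : Series → Series
Δ F n = F n -ℤ shift 1 F n

1-X-⊛ : ∀ F n → ((one ⊖ X^ 1) ⊛ F) n ≡ Δ F n
1-X-⊛ F n = trans (⊛-distribʳ-⊖ one (X^ 1) F n) (cong₂ _-ℤ_ (X^-⊛ 0 F n) (X^-⊛ 1 F n))

Δ-shift : ∀ r F n → Δ (shift r F) n ≡ shift r (Δ F) n
Δ-shift r F n = trans (cong (shift r F n -ℤ_) (shift-comm r F n)) (sym (shift-⊖ r F (shift 1 F) n))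

partialSums : Series → Series
partialSums h zero = h 0
partialSums h (suc p) = h (suc p) +ℤ partialSums h p

Δ-partialSums : ∀ h → Δ (partialSums h) ≈ h
Δ-partialSums h zero = +ℤ-identityʳ (h 0)
Δ-partialSums h (suc p) = a+b-b≡a (h (suc p)) (partialSums h p)
  where
  a+b-b≡a : ∀ a b → (a +ℤ b) -ℤ b ≡ a
  a+b-b≡a = solve-∀

expand-1-2X+X^ : ∀ r h n → ((one ⊖ X^ 1 ⊖ X^ 1 ⊕ X^ r) ⊛ h) n ≡ h n -ℤ shift 1 h n -ℤ shift 1 h n +ℤ shift r h n
expand-1-2X+X^ r h n =
  trans (⊛-distribʳ-⊕ (one ⊖ X^ 1 ⊖ X^ 1) (X^ r) h n)
    (cong₂ _+ℤ_ (trans (⊛-distribʳ-⊖ (one ⊖ X^ 1) (X^ 1) h n) (cong₂ _-ℤ_ (1-X-⊛ h n) (X^-⊛ 1 h n)))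
                (X^-⊛ r h n))

shift-1-1 : ∀ h n → shift 1 (shift 1 h) n ≡ shift 2 h n
shift-1-1 h zero = refl
shift-1-1 h (suc n) = refl

1-X-1-X-⊛ : ∀ h n → ((one ⊖ X^ 1) ⊛ (one ⊖ X^ 1) ⊛ h) n ≡ Δ (Δ h) n
1-X-1-X-⊛ h n = begin
  ((one ⊖ X^ 1) ⊛ (one ⊖ X^ 1) ⊛ h) n   ≡⟨ ⊛-congˡ h n product ⟩
  ((one ⊖ X^ 1 ⊖ X^ 1 ⊕ X^ 2) ⊛ h) n     ≡⟨ expand-1-2X+X^ 2 h n ⟩
  h n -ℤ shift 1 h n -ℤ shift 1 h n +ℤ shift 2 h n
    ≡⟨ regroup (h n) (shift 1 h n) (shift 2 h n) ⟩
  Δ h n -ℤ (shift 1 h n -ℤ shift 2 h n)  ≡⟨ cong (λ x → Δ h n -ℤ (shift 1 h n -ℤ x)) (sym (shift-1-1 h n)) ⟩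
  Δ h n -ℤ (shift 1 h n -ℤ shift 1 (shift 1 h) n) ≡⟨ cong (Δ h n -ℤ_) (sym (shift-⊖ 1 h (shift 1 h) n)) ⟩
  Δ (Δ h) n                              ∎
  where
  open ≡-Reasoning
  product : ∀ i → ((one ⊖ X^ 1) ⊛ (one ⊖ X^ 1)) i ≡ (one ⊖ X^ 1 ⊖ X^ 1 ⊕ X^ 2) i
  product i = trans (1-X-⊛ (one ⊖ X^ 1) i) (coefficients i)
    where
    coefficients : ∀ i → Δ (one ⊖ X^ 1) i ≡ (one ⊖ X^ 1 ⊖ X^ 1 ⊕ X^ 2) i
    coefficients 0 = refl
    coefficients 1 = refl
    coefficients 2 = refl
    coefficients (suc (suc (suc i))) = refl
  regroup : ∀ a b c → a -ℤ b -ℤ b +ℤ c ≡ (a -ℤ b) -ℤ (b -ℤ c)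
  regroup = solve-∀

-- Generating functions

sameOrder-ω-[] : ∀ k → sameOrder (ω k) [] ≡ false
sameOrder-ω-[] k with descTo4 k
... | [] = refl
... | _ ∷ _ = refl

count-0 : ∀ k → count k 0 ≡ 1
count-0 k rewrite sameOrder-ω-[] k = refl

h₃ : Series
h₃ = g 3 ⊖ one

g₃-identity : (one ⊖ X^ 1) ⊛ (one ⊖ X^ 1 ⊖ X^ 2) ⊛ g 3 ≈ X^ 3 ⊖ X^ 1 ⊕ one
g₃-identity n = trans (⊛-congˡ (g 3) n product) (trans (expand-1-2X+X^ 3 (g 3) n) (coefficients n))
  where
  product : ∀ i → ((one ⊖ X^ 1) ⊛ (one ⊖ X^ 1 ⊖ X^ 2)) i ≡ (one ⊖ X^ 1 ⊖ X^ 1 ⊕ X^ 3) i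
  product i = trans (1-X-⊛ (one ⊖ X^ 1 ⊖ X^ 2) i) (Δ-coefficients i)
    where
    Δ-coefficients : ∀ i → Δ (one ⊖ X^ 1 ⊖ X^ 2) i ≡ (one ⊖ X^ 1 ⊖ X^ 1 ⊕ X^ 3) i
    Δ-coefficients 0 = refl
    Δ-coefficients 1 = refl
    Δ-coefficients 2 = refl
    Δ-coefficients 3 = refl
    Δ-coefficients (suc (suc (suc (suc i)))) = refl
  recursion : ∀ m → g 3 (3 + m) ≡ 1ℤ +ℤ (g 3 (2 + m) +ℤ (g 3 (1 + m) +ℤ 0ℤ))
  recursion m = cong ℤ.+_ (count-recursion 0 (2 + m))
  second-difference : ∀ {c₁ c₂ c₃ c₄} → c₃ ≡ 1ℤ +ℤ (c₂ +ℤ (c₁ +ℤ 0ℤ)) → c₄ ≡ 1ℤ +ℤ (c₃ +ℤ (c₂ +ℤ 0ℤ)) →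
                      c₄ -ℤ c₃ -ℤ c₃ +ℤ c₁ ≡ 0ℤ
  second-difference {c₁} {c₂} refl refl = cancel c₁ c₂
    where
    cancel : ∀ a b → (1ℤ +ℤ ((1ℤ +ℤ (b +ℤ (a +ℤ 0ℤ))) +ℤ (b +ℤ 0ℤ))) -ℤ (1ℤ +ℤ (b +ℤ (a +ℤ 0ℤ)))
                     -ℤ (1ℤ +ℤ (b +ℤ (a +ℤ 0ℤ))) +ℤ a ≡ 0ℤ
    cancel = solve-∀
  coefficients : ∀ n → g 3 n -ℤ shift 1 (g 3) n -ℤ shift 1 (g 3) n +ℤ shift 3 (g 3) n ≡ (X^ 3 ⊖ X^ 1 ⊕ one) n
  coefficients 0 = refl
  coefficients 1 = refl
  coefficients 2 = refl
  coefficients 3 = refl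
  coefficients (suc (suc (suc (suc q)))) = second-difference {c₂ = g 3 (2 + q)} (recursion q) (recursion (suc q))

-- The terms a ≥ 1 of count-recursion for count (4 + e) (p + 2) …
innerTerms : ℕ → ℕ → ℤ
innerTerms e p = sumBelow p (λ i → g (3 + residual (suc e) (suc i)) (p ∸ i))

-- … and their counterpart in the right-hand side of the theorem, with Q = h₃ / (1 − x).
seriesTerms : ℕ → ℕ → ℤ
seriesTerms e p = sumBelow (suc e) (λ i → shift i (g (2 + e ∸ i + 1) ⊖ one) p) +ℤ shift (suc e) (partialSums h₃) p

g-0 : ∀ k → (g k ⊖ one) 0 ≡ 0ℤ
g-0 k rewrite count-0 k = refl

innerTerms≡seriesTerms : ∀ p e → innerTerms e p ≡ seriesTerms e p
innerTerms≡seriesTerms zero e =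
  sym (cong₂ _+ℤ_ (cong₂ _+ℤ_ (g-0 (2 + e + 1)) (sumBelow-zero e (λ _ → refl))) refl)
innerTerms≡seriesTerms (suc p) (suc e) = begin
  g (4 + e) (suc p) +ℤ innerTerms e p                 ≡⟨ cong (g (4 + e) (suc p) +ℤ_) (innerTerms≡seriesTerms p e) ⟩
  g (4 + e) (suc p) +ℤ (S +ℤ U)                       ≡⟨ cong (λ k → g k (suc p) +ℤ (S +ℤ U)) (+-comm 1 (3 + e)) ⟩
  g (3 + e + 1) (suc p) +ℤ (S +ℤ U)                   ≡⟨ reassociate (g (3 + e + 1) (suc p)) S U ⟩
  seriesTerms (suc e) (suc p)                         ∎
  where
  open ≡-Reasoning
  S = sumBelow (suc e) (λ i → shift i (g (2 + e ∸ i + 1) ⊖ one) p)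
  U = shift (suc e) (partialSums h₃) p
  reassociate : ∀ a b c → a +ℤ (b +ℤ c) ≡ ((a -ℤ 0ℤ) +ℤ b) +ℤ c
  reassociate = solve-∀
innerTerms≡seriesTerms (suc p) zero = begin
  g 3 (suc p) +ℤ innerTerms 0 p                       ≡⟨ cong (g 3 (suc p) +ℤ_) (innerTerms≡seriesTerms p 0) ⟩
  g 3 (suc p) +ℤ seriesTerms 0 p                      ≡⟨ cong (g 3 (suc p) +ℤ_) Q≡ ⟩
  g 3 (suc p) +ℤ partialSums h₃ p                     ≡⟨ reassociate (g 3 (suc p)) (partialSums h₃ p) ⟩
  seriesTerms 0 (suc p)                               ∎
  where
  open ≡-Reasoning
  Q≡ : seriesTerms 0 p ≡ partialSums h₃ p
  Q≡ = trans (cong (_+ℤ shift 1 (partialSums h₃) p) (+ℤ-identityʳ (h₃ p)))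
             (trans (cong (_+ℤ shift 1 (partialSums h₃) p) (sym (Δ-partialSums h₃ p))) (a-b+b≡a _ _))
    where
    a-b+b≡a : ∀ a b → (a -ℤ b) +ℤ b ≡ a
    a-b+b≡a = solve-∀
  reassociate : ∀ a b → a +ℤ b ≡ ((a -ℤ 0ℤ) +ℤ 0ℤ) +ℤ b
  reassociate = solve-∀


module _ (e : ℕ) where

  -- The right-hand side of the theorem for k = 4 + e, before multiplication by 1 − x.
  B : Series
  B = one ⊕ X^ 1 ⊛ (g (3 + e) ⊖ one)
          ⊕ sumS (map (λ r → X^ r ⊛ (g (4 + e ∸ r + 1) ⊖ one)) (map (2 +_) (upTo (1 + e))))

  B≥2 : Series
  B≥2 n = sumBelow (suc e) (λ i → shift (2 + i) (g (2 + e ∸ i + 1) ⊖ one) n)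

  U : Series
  U = shift (3 + e) (partialSums h₃)

  B-coefficient : ∀ n → B n ≡ one n +ℤ shift 1 (g (3 + e) ⊖ one) n +ℤ B≥2 n
  B-coefficient n = cong₂ _+ℤ_ (cong (one n +ℤ_) (X^-⊛ 1 _ n)) (begin
    sumS (map F (map (2 +_) (upTo (1 + e)))) n   ≡⟨ cong (λ l → sumS l n) (sym (map-∘ {g = F} {f = 2 +_} (upTo (1 + e)))) ⟩
    sumS (map (F ∘ (2 +_)) (upTo (1 + e))) n     ≡⟨ sumS≡sumBelow (F ∘ (2 +_)) (suc e) n ⟩
    sumBelow (suc e) (λ i → F (2 + i) n)         ≡⟨ sumBelow-cong (suc e) (λ i → X^-⊛ (2 + i) (g (2 + e ∸ i + 1) ⊖ one) n) ⟩
    B≥2 n                                        ∎)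
    where
    open ≡-Reasoning
    F : ℕ → Series
    F r = X^ r ⊛ (g (4 + e ∸ r + 1) ⊖ one)

  Δg-recursion : ∀ m → Δ (g (4 + e)) (suc m) ≡ sumBelow m (λ a → g (3 + residual (suc e) a) (m ∸ a))
  Δg-recursion m = trans (cong (_-ℤ g (4 + e) m) (trans (cong ℤ.+_ count≡) (cong (g (4 + e) m +ℤ_) (+sum≡sumBelow _ m))))
                         (a+b-a≡b (g (4 + e) m) _)
    where
    terms = sum (map (λ a → count (3 + residual (suc e) a) (m ∸ a)) (upTo m))
    count≡ : count (4 + e) (suc m) ≡ count (4 + e) m + terms
    count≡ = trans (count-recursion (suc e) m) (cong (_+ terms) (length-map _ (avoiders (4 + e) m)))
    a+b-a≡b : ∀ a b → (a +ℤ b) -ℤ a ≡ b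
    a+b-a≡b = solve-∀

  Δg≡B+U : ∀ n → Δ (g (4 + e)) n ≡ B n +ℤ U n
  Δg≡B+U zero = begin
    Δ (g (4 + e)) 0                          ≡⟨ cong (λ c → ℤ.+ c -ℤ 0ℤ) (count-0 (4 + e)) ⟩
    1ℤ +ℤ 0ℤ +ℤ 0ℤ +ℤ 0ℤ                      ≡⟨ cong (λ x → 1ℤ +ℤ 0ℤ +ℤ x +ℤ 0ℤ) (sym (sumBelow-zero (suc e) (λ _ → refl))) ⟩
    one 0 +ℤ shift 1 (g (3 + e) ⊖ one) 0 +ℤ B≥2 0 +ℤ U 0
                                             ≡⟨ cong (_+ℤ U 0) (sym (B-coefficient 0)) ⟩
    B 0 +ℤ U 0                               ∎
    where open ≡-Reasoning
  Δg≡B+U (suc zero) = begin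
    Δ (g (4 + e)) 1                          ≡⟨ Δg-recursion 0 ⟩
    0ℤ +ℤ 0ℤ +ℤ 0ℤ +ℤ 0ℤ                      ≡⟨ cong₂ (λ x y → 0ℤ +ℤ x +ℤ y +ℤ 0ℤ)
                                                      (sym (g-0 (3 + e))) (sym (sumBelow-zero (suc e) (λ _ → refl))) ⟩
    one 1 +ℤ shift 1 (g (3 + e) ⊖ one) 1 +ℤ B≥2 1 +ℤ U 1
                                             ≡⟨ cong (_+ℤ U 1) (sym (B-coefficient 1)) ⟩
    B 1 +ℤ U 1                               ∎
    where open ≡-Reasoning
  Δg≡B+U (suc (suc p)) = begin
    Δ (g (4 + e)) (2 + p)                    ≡⟨ Δg-recursion (suc p) ⟩
    g (3 + residual (suc e) 0) (suc p) +ℤ innerTerms e p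
                                             ≡⟨ cong₂ (λ r x → g (3 + (e ∸ r)) (suc p) +ℤ x)
                                                      (⊓-zeroʳ e) (innerTerms≡seriesTerms p e) ⟩
    g (3 + e) (suc p) +ℤ (B≥2 (2 + p) +ℤ U (2 + p))
                                             ≡⟨ reassociate (g (3 + e) (suc p)) (B≥2 (2 + p)) (U (2 + p)) ⟩
    one (2 + p) +ℤ shift 1 (g (3 + e) ⊖ one) (2 + p) +ℤ B≥2 (2 + p) +ℤ U (2 + p)
                                             ≡⟨ cong (_+ℤ U (2 + p)) (sym (B-coefficient (2 + p))) ⟩
    B (2 + p) +ℤ U (2 + p)                   ∎
    where
    open ≡-Reasoning
    reassociate : ∀ a b c → a +ℤ (b +ℤ c) ≡ ((0ℤ +ℤ (a -ℤ 0ℤ)) +ℤ b) +ℤ c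
    reassociate = solve-∀

  g-identity : (one ⊖ X^ 1) ⊛ (one ⊖ X^ 1) ⊛ g (4 + e) ≈ (one ⊖ X^ 1) ⊛ B ⊕ X^ (3 + e) ⊛ h₃
  g-identity n = begin
    ((one ⊖ X^ 1) ⊛ (one ⊖ X^ 1) ⊛ g (4 + e)) n      ≡⟨ 1-X-1-X-⊛ (g (4 + e)) n ⟩
    Δ (g (4 + e)) n -ℤ shift 1 (Δ (g (4 + e))) n       ≡⟨ cong₂ _-ℤ_ (Δg≡B+U n)
                                                            (trans (shift-cong 1 n Δg≡B+U) (shift-⊕ 1 B U n)) ⟩
    (B n +ℤ U n) -ℤ (shift 1 B n +ℤ shift 1 U n)       ≡⟨ regroup (B n) (U n) (shift 1 B n) (shift 1 U n) ⟩
    Δ B n +ℤ Δ U n                                     ≡⟨ cong₂ _+ℤ_ (sym (1-X-⊛ B n)) ΔU≡ ⟩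
    ((one ⊖ X^ 1) ⊛ B ⊕ X^ (3 + e) ⊛ h₃) n            ∎
    where
    open ≡-Reasoning
    regroup : ∀ b u b′ u′ → (b +ℤ u) -ℤ (b′ +ℤ u′) ≡ (b -ℤ b′) +ℤ (u -ℤ u′)
    regroup = solve-∀
    ΔU≡ : Δ U n ≡ (X^ (3 + e) ⊛ h₃) n
    ΔU≡ = trans (Δ-shift (3 + e) (partialSums h₃) n)
                (trans (shift-cong (3 + e) n (Δ-partialSums h₃)) (sym (X^-⊛ (3 + e) h₃ n)))

mainTheorem13 :
    ((one ⊖ X^ 1) ⊛ (one ⊖ X^ 1 ⊖ X^ 2) ⊛ g 3 ≈ X^ 3 ⊖ X^ 1 ⊕ one)
    × (∀ (k : ℕ) → k > 3 →
        (one ⊖ X^ 1) ⊛ (one ⊖ X^ 1) ⊛ g k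
          ≈ (one ⊖ X^ 1) ⊛ (one ⊕ X^ 1 ⊛ (g (k ∸ 1) ⊖ one)
                              ⊕ sumS (map (λ r → X^ r ⊛ (g (k ∸ r + 1) ⊖ one)) (map (2 +_) (upTo (k ∸ 3)))))
            ⊕ X^ (k ∸ 1) ⊛ (g 3 ⊖ one))
mainTheorem13 = g₃-identity , λ { (suc (suc (suc (suc e)))) (s≤s (s≤s (s≤s (s≤s _)))) → g-identity e }
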